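{- Let $(h,p,\mathbf d,\mathbf e)$ be a den with associated sequence $\mathbf g$. Set $g_0=0$. (i) If $\pi=(\pi_1,\dots,\pi_r)$ is a nest in the den, then (a) for $1\le k\le h$, $\pi_i$ has a non-sink lattice point on the line $x=k-1$ if and only if $1\le i\le g_k$; and (b) there are unique partitions $\lambda_{(1)},\dots,\lambda_{(h-1)}$ with $\ell(\lambda_{(k)})\le\min(g_k,g_{k+1})$ such that, setting $\lambda_{(0)}=\lambda_{(h)}=\varnothing$ and padding partitions with zeros, for all $1\le k\le h$ and $1\le i\le g_k$ the $y$-coordinates of the non-sink lattice points of $\pi_i$ on $x=k-1$ form the interval \[I_{k,i}=[\,e_k-g_k+i-(\lambda_{(k)})_i,\ e_{k-1}-g_{k-1}+i-(\lambda_{(k-1)})_i\,].\] (ii) Conversely, let $\lambda_{(1)},\dots,\lambda_{(h-1)}$ be partitions with $\ell(\lambda_{(k)})\le\min(g_k,g_{k+1})$, set $\lambda_{(0)}=\lambda_{(h)}=\varnothing$, and suppose $e_k-g_k-(\lambda_{(k)})_i\le e_{k-1}-g_{k-1}-(\lambda_{(k-1)})_i$ for all $1\le k\le h$ and $1\le i\le g_k$. Then there is a unique nest $\pi$ in the den such that for all $1\le k\le h$ and $1\le i\le g_k$ the $y$-coordinates of the non-sink lattice points of $\pi_i$ on $x=k-1$ form the interval $I_{k,i}$.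
   Context: A den is a tuple $(h,p,\mathbf d,\mathbf e)$ with $h$ a positive integer, $p$ an irrational real, $\mathbf d=(d_0,\dots,d_h)$, $\mathbf e=(e_0,\dots,e_h)$ integer sequences such that $(d_i-d_j+1)/(j-i)>p$ for $0\le i<j\le h-1$; $(e_i-e_j-1)/(j-i)<p$ for $1\le i<j\le h$; $d_0>e_0$, $d_h<e_h$, $\sum_id_i=\sum_ie_i$. Sources are lattice points $(i,j)$ with $e_i<j\le d_i$; sinks are lattice points $(i,j)$ with $d_i<j\le e_i$. $\mathbf g=(g_1,\dots,g_h)$ with $g_k=\sum_{i=0}^{k-1}(d_i-e_i)$. An east end path is a lattice path with unit south $(0,-1)$ and east $(1,0)$ steps ending with an east step. East end paths $\pi,\pi'$ are nested with $\pi$ below $\pi'$ if the interval of $x$-coordinates of $\pi'$ lies in that of $\pi$, and for every integer $i$ in the former, the intervals $[v_i,w_i]$, $[v_i',w_i']$ of $y$-coordinates of the points of $\pi$, $\pi'$ on $x=i$ satisfy $v_i<v_i'$ and $w_i<w_i'$. A nest is a tuple $(\pi_1,\dots,\pi_r)$ of east end paths whose starting points are exactly the sources and endpoints exactly the sinks, with $\pi_k$ nested below $\pi_l$ for $k<l$, such that every lattice point $(i,j)$ on a path other than its final point satisfies $j\le d_i$. A non-sink lattice point of $\pi_i$ is a lattice point of $\pi_i$ other than its final point. -}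

module Defs where

open import Data.Nat as ℕ using (ℕ; zero; suc; _∸_; _≤?_)
open import Data.Integer as ℤ using (ℤ; +_; 0ℤ; 1ℤ; _+_; _-_)
open import Data.Rational as ℚ using (ℚ; _/_)
open import Data.Fin as Fin using (Fin; toℕ)
open import Data.List using (List; []; _∷_; _∷ʳ_; length; lookup)
open import Data.List.Membership.Propositional using (_∈_)
open import Data.List.Relation.Unary.All using (All)
open import Data.List.Relation.Unary.Linked using (Linked)
open import Data.Product using (Σ; ∃; _×_; _,_; proj₁; proj₂)
open import Data.Sum using (_⊎_)
open import Data.Empty using (⊥)
open import Relation.Nullary using (yes; no)
open import Relation.Binary.PropositionalEquality using (_≡_)

_⇔_ : Set → Set → Set
A ⇔ B = (A → B) × (B → A)
infix 3 _⇔_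

-- An irrational real number p, given by its Dedekind cut:
-- L q means q < p, U q means p < q.  Irrationality: every rational
-- lies strictly on one side.
record IrrationalCut : Set₁ where
  field
    L U           : ℚ → Set
    L-inhabited   : ∃ L
    U-inhabited   : ∃ U
    L-down        : ∀ {q r} → q ℚ.≤ r → L r → L q
    U-up          : ∀ {q r} → q ℚ.≤ r → U q → U r
    L-open        : ∀ {q} → L q → Σ ℚ λ r → q ℚ.< r × L r
    U-open        : ∀ {r} → U r → Σ ℚ λ q → q ℚ.< r × U q
    disjoint      : ∀ {q} → L q → U q → ⊥
    irrational    : ∀ q → L q ⊎ U q

-- Sequences d, e are functions ℕ → ℤ; only the values at 0..h matter.

sumTo : (ℕ → ℤ) → ℕ → ℤ
sumTo f zero    = 0ℤ
sumTo f (suc n) = sumTo f n + f n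

gseq : (d e : ℕ → ℤ) → ℕ → ℤ
gseq d e k = sumTo (λ i → d i - e i) k

-- den condition (h , p , d , e), with j = i + suc m (so j - i = suc m)
IsDen : ℕ → IrrationalCut → (d e : ℕ → ℤ) → Set
IsDen h p d e =
  1 ℕ.≤ h
  × (∀ i m → i ℕ.+ suc m ℕ.≤ h ∸ 1 →
       IrrationalCut.U p ((d i - d (i ℕ.+ suc m) + 1ℤ) / suc m))
  × (∀ i m → 1 ℕ.≤ i → i ℕ.+ suc m ℕ.≤ h →
       IrrationalCut.L p ((e i - e (i ℕ.+ suc m) - 1ℤ) / suc m))
  × e 0 ℤ.< d 0
  × d h ℤ.< e h
  × sumTo d (suc h) ≡ sumTo e (suc h)

Point : Set
Point = ℤ × ℤ

data Step : Set where
  S E : Step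

move : Point → Step → Point
move (x , y) S = (x , y - 1ℤ)
move (x , y) E = (x + 1ℤ , y)

-- An east end path: starting point together with the list of steps
-- before the final east step.  Its steps are  body ∷ʳ E.
EEPath : Set
EEPath = Point × List Step

start : EEPath → Point
start = proj₁

steps : EEPath → List Step
steps π = proj₂ π ∷ʳ E

pointsFrom : Point → List Step → List Point
pointsFrom p []       = p ∷ []
pointsFrom p (s ∷ ss) = p ∷ pointsFrom (move p s) ss

nonSinkFrom : Point → List Step → List Point
nonSinkFrom p []       = []
nonSinkFrom p (s ∷ ss) = p ∷ nonSinkFrom (move p s) ss

endFrom : Point → List Step → Point
endFrom p []       = p
endFrom p (s ∷ ss) = endFrom (move p s) ss

pathPoints : EEPath → List Point
pathPoints π = pointsFrom (start π) (steps π)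

nonSinkPoints : EEPath → List Point
nonSinkPoints π = nonSinkFrom (start π) (steps π)

endPoint : EEPath → Point
endPoint π = endFrom (start π) (steps π)

YInterval : EEPath → ℤ → ℤ → ℤ → Set
YInterval π i v w = ∀ y → ((i , y) ∈ pathPoints π) ⇔ (v ℤ.≤ y × y ℤ.≤ w)

NestedBelow : EEPath → EEPath → Set
NestedBelow π π' =
  (proj₁ (start π) ℤ.≤ proj₁ (start π') × proj₁ (endPoint π') ℤ.≤ proj₁ (endPoint π))
  × (∀ i → proj₁ (start π') ℤ.≤ i → i ℤ.≤ proj₁ (endPoint π') →
       ∀ v w v' w' → YInterval π i v w → YInterval π' i v' w' →
       v ℤ.< v' × w ℤ.< w')

IsSource : ℕ → (d e : ℕ → ℤ) → Point → Set
IsSource h d e (x , y) = Σ ℕ λ i → i ℕ.≤ h × x ≡ + i × e i ℤ.< y × y ℤ.≤ d i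

IsSink : ℕ → (d e : ℕ → ℤ) → Point → Set
IsSink h d e (x , y) = Σ ℕ λ i → i ℕ.≤ h × x ≡ + i × d i ℤ.< y × y ℤ.≤ e i

-- a nest (π_1, ..., π_r) is a list of east end paths; π_{k+1} = lookup πs k
IsNest : ℕ → (d e : ℕ → ℤ) → List EEPath → Set
IsNest h d e πs =
  (∀ k → IsSource h d e (start (lookup πs k)))
  × (∀ pt → IsSource h d e pt → Σ (Fin (length πs)) λ k → start (lookup πs k) ≡ pt)
  × (∀ k l → start (lookup πs k) ≡ start (lookup πs l) → k ≡ l)
  × (∀ k → IsSink h d e (endPoint (lookup πs k)))
  × (∀ pt → IsSink h d e pt → Σ (Fin (length πs)) λ k → endPoint (lookup πs k) ≡ pt)
  × (∀ k l → endPoint (lookup πs k) ≡ endPoint (lookup πs l) → k ≡ l)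
  × (∀ k l → k Fin.< l → NestedBelow (lookup πs k) (lookup πs l))
  × (∀ k (i : ℕ) j → (+ i , j) ∈ nonSinkPoints (lookup πs k) → j ℤ.≤ d i)

IsPartition : List ℕ → Set
IsPartition xs = Linked ℕ._≥_ xs × All (ℕ._<_ 0) xs

-- (λ)_i, 1-indexed, padded with zeros
entry : List ℕ → ℕ → ℕ
entry xs       zero          = 0
entry []       (suc i)       = 0
entry (x ∷ xs) (suc zero)    = x
entry (x ∷ xs) (suc (suc i)) = entry xs (suc i)

-- lam k is λ_(k) for 1 ≤ k ≤ h-1; lamExt sets λ_(0) = λ_(h) = ∅
-- (values of lam outside 1..h-1 are ignored)
lamExt : ℕ → (ℕ → List ℕ) → ℕ → List ℕ
lamExt h lam zero = []
lamExt h lam (suc k) with h ≤? suc k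
... | yes _ = []
... | no _  = lam (suc k)

LamFamily : ℕ → (d e : ℕ → ℤ) → (ℕ → List ℕ) → Set
LamFamily h d e lam =
  ∀ k → 1 ℕ.≤ k → k ℕ.≤ h ∸ 1 →
    IsPartition (lam k)
    × + length (lam k) ℤ.≤ gseq d e k
    × + length (lam k) ℤ.≤ gseq d e (suc k)

-- endpoints of I_{k,i} for k = suc k'
Ilo : ℕ → (d e : ℕ → ℤ) → (ℕ → List ℕ) → ℕ → ℕ → ℤ
Ilo h d e lam k' i =
  e (suc k') - gseq d e (suc k') + + i - + entry (lamExt h lam (suc k')) i

Ihi : ℕ → (d e : ℕ → ℤ) → (ℕ → List ℕ) → ℕ → ℕ → ℤ
Ihi h d e lam k' i =
  e k' - gseq d e k' + + i - + entry (lamExt h lam k') i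

HasIntervals : ℕ → (d e : ℕ → ℤ) → (ℕ → List ℕ) → List EEPath → Set
HasIntervals h d e lam πs =
  (∀ k' i → suc k' ℕ.≤ h → 1 ℕ.≤ i → + i ℤ.≤ gseq d e (suc k') → i ℕ.≤ length πs)
  × (∀ k' (f : Fin (length πs)) → suc k' ℕ.≤ h →
       + suc (toℕ f) ℤ.≤ gseq d e (suc k') →
       ∀ y → ((+ k' , y) ∈ nonSinkPoints (lookup πs f))
             ⇔ (Ilo h d e lam k' (suc (toℕ f)) ℤ.≤ y × y ℤ.≤ Ihi h d e lam k' (suc (toℕ f))))

NonSinkColumns : ℕ → (d e : ℕ → ℤ) → List EEPath → Set
NonSinkColumns h d e πs =
  ∀ k' → suc k' ℕ.≤ h → ∀ (f : Fin (length πs)) →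
    (Σ ℤ λ y → (+ k' , y) ∈ nonSinkPoints (lookup πs f))
    ⇔ (+ suc (toℕ f) ℤ.≤ gseq d e (suc k'))

IntervalIneq : ℕ → (d e : ℕ → ℤ) → (ℕ → List ℕ) → Set
IntervalIneq h d e lam =
  ∀ k' i → suc k' ℕ.≤ h → 1 ℕ.≤ i → + i ℤ.≤ gseq d e (suc k') →
    e (suc k') - gseq d e (suc k') - + entry (lamExt h lam (suc k')) i
    ℤ.≤ e k' - gseq d e k' - + entry (lamExt h lam k') i

{-# OPTIONS --safe #-}
module Submission where

-- The den inequalities force δ k = d k − e k to change sign only once, from positive to
-- negative, so g is unimodal. Ranking a lattice point (c , y) by y − (e c − g c), the
-- sources on x = c are exactly the ranks in (g c , g (c+1)] and the sinks those in
-- (g (c+1) , g c]. Nesting orders both the starts and the ends of a nest, so π_i joins the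
-- source of rank i to the sink of rank i and occupies exactly the columns c with
-- i ≤ g (c+1), which is (i)(a). It enters column c+1 at most at height e (c+1) − g (c+1) + i
-- (downward induction on i, from nesting and the bound by d); the deficits are the parts
-- of λ_(c+1), decreasing in i because nested paths are strictly ordered. Conversely, the
-- inequalities of (ii) say that the intervals I_(k,i) stack into an east end path from the
-- source of rank i to the sink of rank i, strictly increasing in i. Uniqueness in both
-- parts holds because a path is determined by its non-sink points.

open import Defs
open import Data.Empty using (⊥; ⊥-elim)
open import Data.Fin as Fin using (Fin; toℕ)
import Data.Fin.Properties as FinP
open import Data.Integer as ℤ using (ℤ; +_; -[1+_]; 0ℤ; 1ℤ; _+_; _-_)
import Data.Integer.Properties as ℤP
open import Data.Integer.Tactic.RingSolver using (solve-∀)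
open import Data.List using (List; []; _∷_; _∷ʳ_; length; lookup; tabulate)
open import Data.List.Membership.Propositional using (_∈_)
open import Data.List.Membership.Propositional.Properties using (∈-++⁺ˡ; ∈-++⁺ʳ; ∈-++⁻)
import Data.List.Properties as LP
open import Data.List.Relation.Unary.All using (All; []; _∷_)
open import Data.List.Relation.Unary.Any using (here; there)
open import Data.List.Relation.Unary.Linked using (Linked; [-]; []; _∷_)
open import Data.Nat as ℕ using (ℕ; zero; suc; _∸_; z≤n; s≤s)
open import Data.Nat.Induction using (<-rec)
import Data.Nat.Properties as ℕP
open import Data.Product using (Σ; ∃; ∃₂; _×_; _,_; proj₁; proj₂)
open import Data.Product.Properties using (,-injectiveˡ; ,-injectiveʳ)
import Data.Rational as ℚ
import Data.Rational.Properties as ℚP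
import Data.Rational.Unnormalised as ℚᵘ
import Data.Rational.Unnormalised.Properties as ℚᵘP
open import Data.Sum using (_⊎_; inj₁; inj₂; [_,_]′)
open import Function using (id; _∘_)
open import Relation.Binary.Definitions using (tri<; tri≈; tri>)
open import Relation.Binary.PropositionalEquality
open import Relation.Nullary using (¬_; yes; no)
open import Relation.Nullary.Decidable.Core using (toSum)

m<n⇒m≤n∸1 : ∀ {m n} → m ℕ.< n → m ℕ.≤ n ∸ 1
m<n⇒m≤n∸1 (s≤s le) = le

m≤n∸1⇒m<n : ∀ {m n} → 1 ℕ.≤ n → m ℕ.≤ n ∸ 1 → m ℕ.< n
m≤n∸1⇒m<n {n = suc n} _ le = s≤s le

-- Integer inequalities are reduced to nonnegativity of a difference, which the ring solver computes.
Nonneg : ℤ → Set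
Nonneg x = 0ℤ ℤ.≤ x

≤-byDiff : ∀ {a b c} → b - a ≡ c → Nonneg c → a ℤ.≤ b
≤-byDiff eq c≥0 = ℤP.0≤i-j⇒j≤i (subst Nonneg (sym eq) c≥0)

<-byDiff : ∀ {a b c} → b - (1ℤ + a) ≡ c → Nonneg c → a ℤ.< b
<-byDiff eq c≥0 = ℤP.suc[i]≤j⇒i<j (≤-byDiff eq c≥0)

≤⇒diff : ∀ {a b} → a ℤ.≤ b → Nonneg (b - a)
≤⇒diff = ℤP.i≤j⇒0≤j-i

<⇒diff : ∀ {a b} → a ℤ.< b → Nonneg (b - (1ℤ + a))
<⇒diff a<b = ℤP.i≤j⇒0≤j-i (ℤP.i<j⇒suc[i]≤j a<b)

+-nonneg : ∀ {x y} → Nonneg x → Nonneg y → Nonneg (x + y)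
+-nonneg = ℤP.+-mono-≤

ℕ-nonneg : ∀ n → Nonneg (+ n)
ℕ-nonneg n = ℤ.+≤+ z≤n

x-n≤x : ∀ x n → x - + n ℤ.≤ x
x-n≤x x n = ≤-byDiff (ring x (+ n)) (ℕ-nonneg n)
  where
  ring : ∀ x n → x - (x - n) ≡ n
  ring = solve-∀

<1+⇒≤ : ∀ {a b} → a ℤ.< 1ℤ + b → a ℤ.≤ b
<1+⇒≤ {a} {b} lt = ≤-byDiff (ring a b) (<⇒diff lt)
  where
  ring : ∀ a b → b - a ≡ 1ℤ + b - (1ℤ + a)
  ring = solve-∀

0<⇒≡+suc : ∀ {v} → 0ℤ ℤ.< v → ∃ λ n → v ≡ + suc n
0<⇒≡+suc {+ suc n} _ = n , refl
0<⇒≡+suc {+ zero} (ℤ.+<+ ())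

x≤x+n : ∀ x n → x ℤ.≤ x + + n
x≤x+n x n = ≤-byDiff (ring x (+ n)) (ℕ-nonneg n)
  where
  ring : ∀ x n → x + n - x ≡ n
  ring = solve-∀

x<x+1 : ∀ x → x ℤ.< x + 1ℤ
x<x+1 x = <-byDiff (ring x) (ℕ-nonneg 0)
  where
  ring : ∀ x → x + 1ℤ - (1ℤ + x) ≡ 0ℤ
  ring = solve-∀

x-0≡x : ∀ x → x - + 0 ≡ x
x-0≡x = ℤP.+-identityʳ

x-1-n≡x-[1+n] : ∀ x n → x - 1ℤ - + n ≡ x - + suc n
x-1-n≡x-[1+n] x n = ring x (+ n)
  where
  ring : ∀ x n → x - 1ℤ - n ≡ x - (1ℤ + n)
  ring = solve-∀

x+1+j≡x+[1+j] : ∀ x j → x + 1ℤ + + j ≡ x + + suc j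
x+1+j≡x+[1+j] x j = ring x (+ j)
  where
  ring : ∀ x j → x + 1ℤ + j ≡ x + (1ℤ + j)
  ring = solve-∀

+-cancelˡ : ∀ x {a b} → x + a ≡ x + b → a ≡ b
+-cancelˡ x {a} {b} eq = trans (ring x a) (trans (cong (_- x) eq) (sym (ring x b)))
  where
  ring : ∀ x a → a ≡ x + a - x
  ring = solve-∀

+-cancelˡ-ℕ : ∀ x {m n} → x + + m ≡ x + + n → m ≡ n
+-cancelˡ-ℕ x eq = ℤP.+-injective (+-cancelˡ x eq)

x-m≡x-n⇒m≡n : ∀ x {m n} → x - + m ≡ x - + n → m ≡ n
x-m≡x-n⇒m≡n x eq = ℤP.+-injective (ℤP.neg-injective (+-cancelˡ x eq))

x-n≤x-m⇒m≤n : ∀ x m n → x - + n ℤ.≤ x - + m → m ℕ.≤ n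
x-n≤x-m⇒m≤n x m n le = ℤ.drop‿+≤+ (≤-byDiff (ring x (+ m) (+ n)) (≤⇒diff le))
  where
  ring : ∀ x m n → n - m ≡ x - m - (x - n)
  ring = solve-∀

interval-lower-unique : ∀ {a b a′ b′} → a ℤ.≤ b →
  (∀ y → (a ℤ.≤ y × y ℤ.≤ b) ⇔ (a′ ℤ.≤ y × y ℤ.≤ b′)) → a ≡ a′
interval-lower-unique {a} {b} {a′} {b′} a≤b same =
  ℤP.≤-antisym (proj₁ (proj₂ (same a′) (ℤP.≤-refl , ℤP.≤-trans a′≤a (proj₂ a∈′)))) a′≤a
  where
  a∈′ : a′ ℤ.≤ a × a ℤ.≤ b′
  a∈′ = proj₁ (same a) (ℤP.≤-refl , a≤b)
  a′≤a : a′ ℤ.≤ a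
  a′≤a = proj₁ a∈′

interval-upper-unique : ∀ {a b a′ b′} → a ℤ.≤ b →
  (∀ y → (a ℤ.≤ y × y ℤ.≤ b) ⇔ (a′ ℤ.≤ y × y ℤ.≤ b′)) → b ≡ b′
interval-upper-unique {a} {b} {a′} {b′} a≤b same =
  ℤP.≤-antisym b≤b′ (proj₂ (proj₂ (same b′) (ℤP.≤-trans (proj₁ b∈′) b≤b′ , ℤP.≤-refl)))
  where
  b∈′ : a′ ℤ.≤ b × b ℤ.≤ b′
  b∈′ = proj₁ (same b) (a≤b , ℤP.≤-refl)
  b≤b′ : b ℤ.≤ b′
  b≤b′ = proj₂ b∈′

-- Run decomposition of east end paths

-- runs (n₀ ∷ n₁ ∷ …) is S^n₀ E S^n₁ E …, and height y ns j is the height at which the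
-- path starting at height y enters its j-th column.
mutual
  runs : List ℕ → List Step
  runs []       = []
  runs (n ∷ ns) = run n ns

  run : ℕ → List ℕ → List Step
  run zero    ns = E ∷ runs ns
  run (suc n) ns = S ∷ run n ns

runBody : ℕ → List ℕ → List Step
runBody zero    []        = []
runBody zero    (n ∷ ns)  = E ∷ runBody n ns
runBody (suc n) ns        = S ∷ runBody n ns

runBody-∷ʳ : ∀ n ns → runBody n ns ∷ʳ E ≡ run n ns
runBody-∷ʳ zero    []       = refl
runBody-∷ʳ zero    (n ∷ ns) = cong (E ∷_) (runBody-∷ʳ n ns)
runBody-∷ʳ (suc n) ns       = cong (S ∷_) (runBody-∷ʳ n ns)

∷ʳE-as-run : (b : List Step) → ∃₂ λ n ns → b ∷ʳ E ≡ run n ns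
∷ʳE-as-run []      = 0 , [] , refl
∷ʳE-as-run (S ∷ b) = let n , ns , eq = ∷ʳE-as-run b in suc n , ns , cong (S ∷_) eq
∷ʳE-as-run (E ∷ b) = let n , ns , eq = ∷ʳE-as-run b in 0 , n ∷ ns , cong (E ∷_) eq

height : ℤ → List ℕ → ℕ → ℤ
height y []       j       = y
height y (n ∷ ns) zero    = y
height y (n ∷ ns) (suc j) = height (y - + n) ns j

height-0 : ∀ y ns → height y ns 0 ≡ y
height-0 y []       = refl
height-0 y (n ∷ ns) = refl

height-suc≤ : ∀ y ns j → height y ns (suc j) ℤ.≤ height y ns j
height-suc≤ y []       j       = ℤP.≤-refl
height-suc≤ y (n ∷ ns) zero    = subst (ℤ._≤ y) (sym (height-0 (y - + n) ns)) (x-n≤x y n)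
height-suc≤ y (n ∷ ns) (suc j) = height-suc≤ (y - + n) ns j

height-≤start : ∀ y ns j → height y ns j ℤ.≤ y
height-≤start y ns zero    = ℤP.≤-reflexive (height-0 y ns)
height-≤start y ns (suc j) = ℤP.≤-trans (height-suc≤ y ns j) (height-≤start y ns j)

height-beyond : ∀ y ns j → length ns ℕ.≤ j → height y ns (suc j) ≡ height y ns j
height-beyond y []       j       _         = refl
height-beyond y (n ∷ ns) (suc j) (s≤s le) = height-beyond (y - + n) ns j le

OnColumn : ℤ → ℤ → ℕ → Point → Set
OnColumn x y n (a , b) = a ≡ x × y - + n ℤ.≤ b × b ℤ.≤ y

∈nonSinkFrom-run : ∀ n ns x y q → (q ∈ nonSinkFrom (x , y) (run n ns)) ⇔
  (OnColumn x y n q ⊎ q ∈ nonSinkFrom (x + 1ℤ , y - + n) (runs ns))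
∈nonSinkFrom-run zero ns x y (a , b) = to , from
  where
  rest : ∀ {z z′} → z ≡ z′ → (a , b) ∈ nonSinkFrom (x + 1ℤ , z) (runs ns) →
         (a , b) ∈ nonSinkFrom (x + 1ℤ , z′) (runs ns)
  rest eq = subst (λ z → (a , b) ∈ nonSinkFrom (x + 1ℤ , z) (runs ns)) eq
  to : (a , b) ∈ nonSinkFrom (x , y) (run 0 ns) →
       OnColumn x y 0 (a , b) ⊎ (a , b) ∈ nonSinkFrom (x + 1ℤ , y - + 0) (runs ns)
  to (here refl) = inj₁ (refl , ℤP.≤-reflexive (x-0≡x y) , ℤP.≤-refl)
  to (there m)   = inj₂ (rest (sym (x-0≡x y)) m)
  from : OnColumn x y 0 (a , b) ⊎ (a , b) ∈ nonSinkFrom (x + 1ℤ , y - + 0) (runs ns) →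
         (a , b) ∈ nonSinkFrom (x , y) (run 0 ns)
  from (inj₁ (refl , y≤b , b≤y)) =
    here (cong (a ,_) (ℤP.≤-antisym b≤y (subst (ℤ._≤ b) (x-0≡x y) y≤b)))
  from (inj₂ m) = there (rest (x-0≡x y) m)
∈nonSinkFrom-run (suc n) ns x y (a , b) = to , from
  where
  ih = ∈nonSinkFrom-run n ns x (y - 1ℤ) (a , b)
  rest : ∀ {z z′} → z ≡ z′ → (a , b) ∈ nonSinkFrom (x + 1ℤ , z) (runs ns) →
         (a , b) ∈ nonSinkFrom (x + 1ℤ , z′) (runs ns)
  rest eq = subst (λ z → (a , b) ∈ nonSinkFrom (x + 1ℤ , z) (runs ns)) eq
  to : (a , b) ∈ nonSinkFrom (x , y) (run (suc n) ns) →
       OnColumn x y (suc n) (a , b) ⊎ (a , b) ∈ nonSinkFrom (x + 1ℤ , y - + suc n) (runs ns)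
  to (here refl) = inj₁ (refl , x-n≤x y (suc n) , ℤP.≤-refl)
  to (there m) with proj₁ ih m
  ... | inj₁ (refl , lo , hi) =
    inj₁ (refl , subst (ℤ._≤ b) (x-1-n≡x-[1+n] y n) lo , ℤP.≤-trans hi (x-n≤x y 1))
  ... | inj₂ m′ = inj₂ (rest (x-1-n≡x-[1+n] y n) m′)
  from : OnColumn x y (suc n) (a , b) ⊎ (a , b) ∈ nonSinkFrom (x + 1ℤ , y - + suc n) (runs ns) →
         (a , b) ∈ nonSinkFrom (x , y) (run (suc n) ns)
  from (inj₁ (refl , lo , hi)) with b ℤP.≟ y
  ... | yes refl = here refl
  ... | no b≢y = there (proj₂ ih (inj₁ (refl , subst (ℤ._≤ b) (sym (x-1-n≡x-[1+n] y n)) lo ,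
                   ≤-byDiff (ring y b) (<⇒diff (ℤP.≤∧≢⇒< hi b≢y)))))
    where
    ring : ∀ y b → y - 1ℤ - b ≡ y - (1ℤ + b)
    ring = solve-∀
  from (inj₂ m) = there (proj₂ ih (inj₂ (rest (sym (x-1-n≡x-[1+n] y n)) m)))

OnRuns : Point → List ℕ → Point → Set
OnRuns (x , y) ns (a , b) = ∃ λ j → j ℕ.< length ns × a ≡ x + + j ×
  height y ns (suc j) ℤ.≤ b × b ℤ.≤ height y ns j

∈nonSinkFrom-runs : ∀ ns x y q → (q ∈ nonSinkFrom (x , y) (runs ns)) ⇔ OnRuns (x , y) ns q
∈nonSinkFrom-runs []       x y (a , b) = (λ ()) , λ { (j , () , _) }
∈nonSinkFrom-runs (n ∷ ns) x y (a , b) = to , from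
  where
  ih = ∈nonSinkFrom-runs ns (x + 1ℤ) (y - + n) (a , b)
  here-run = ∈nonSinkFrom-run n ns x y (a , b)
  to : (a , b) ∈ nonSinkFrom (x , y) (runs (n ∷ ns)) → OnRuns (x , y) (n ∷ ns) (a , b)
  to m with proj₁ here-run m
  ... | inj₁ (refl , lo , hi) =
    0 , s≤s z≤n , sym (ℤP.+-identityʳ a) , subst (ℤ._≤ b) (sym (height-0 (y - + n) ns)) lo , hi
  ... | inj₂ m′ with proj₁ ih m′
  ... | j , j< , eq , lo , hi = suc j , s≤s j< , trans eq (x+1+j≡x+[1+j] x j) , lo , hi
  from : OnRuns (x , y) (n ∷ ns) (a , b) → (a , b) ∈ nonSinkFrom (x , y) (runs (n ∷ ns))
  from (zero , _ , eq , lo , hi) =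
    proj₂ here-run (inj₁ (trans eq (ℤP.+-identityʳ x) , subst (ℤ._≤ b) (height-0 (y - + n) ns) lo , hi))
  from (suc j , s≤s j< , eq , lo , hi) =
    proj₂ here-run (inj₂ (proj₂ ih (j , j< , trans eq (sym (x+1+j≡x+[1+j] x j)) , lo , hi)))

endFrom-run : ∀ n ns x y → endFrom (x , y) (run n ns) ≡ endFrom (x + 1ℤ , y - + n) (runs ns)
endFrom-run zero    ns x y = cong (λ z → endFrom (x + 1ℤ , z) (runs ns)) (sym (x-0≡x y))
endFrom-run (suc n) ns x y = trans (endFrom-run n ns x (y - 1ℤ))
  (cong (λ z → endFrom (x + 1ℤ , z) (runs ns)) (x-1-n≡x-[1+n] y n))

endFrom-runs : ∀ ns x y → endFrom (x , y) (runs ns) ≡ (x + + length ns , height y ns (length ns))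
endFrom-runs []       x y = cong (_, y) (sym (ℤP.+-identityʳ x))
endFrom-runs (n ∷ ns) x y = begin
  endFrom (x , y) (run n ns)                                      ≡⟨ endFrom-run n ns x y ⟩
  endFrom (x + 1ℤ , y - + n) (runs ns)                            ≡⟨ endFrom-runs ns (x + 1ℤ) (y - + n) ⟩
  (x + 1ℤ + + length ns , height (y - + n) ns (length ns))        ≡⟨ cong (_, _) (x+1+j≡x+[1+j] x (length ns)) ⟩
  (x + + length (n ∷ ns) , height y (n ∷ ns) (length (n ∷ ns)))   ∎
  where open ≡-Reasoning

pointsFrom≡nonSinkFrom∷ʳend : ∀ p ss → pointsFrom p ss ≡ nonSinkFrom p ss ∷ʳ endFrom p ss
pointsFrom≡nonSinkFrom∷ʳend p []       = refl
pointsFrom≡nonSinkFrom∷ʳend p (s ∷ ss) = cong (p ∷_) (pointsFrom≡nonSinkFrom∷ʳend (move p s) ss)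

∈pathPoints⇔ : ∀ π q → (q ∈ pathPoints π) ⇔ (q ∈ nonSinkPoints π ⊎ q ≡ endPoint π)
∈pathPoints⇔ π q = to , from
  where
  split = pointsFrom≡nonSinkFrom∷ʳend (start π) (steps π)
  to : q ∈ pathPoints π → q ∈ nonSinkPoints π ⊎ q ≡ endPoint π
  to m with ∈-++⁻ (nonSinkPoints π) (subst (q ∈_) split m)
  ... | inj₁ m′        = inj₁ m′
  ... | inj₂ (here eq) = inj₂ eq
  from : q ∈ nonSinkPoints π ⊎ q ≡ endPoint π → q ∈ pathPoints π
  from (inj₁ m)  = subst (q ∈_) (sym split) (∈-++⁺ˡ m)
  from (inj₂ eq) = subst (q ∈_) (sym split) (∈-++⁺ʳ (nonSinkPoints π) (here eq))

opaque
  runsOf : EEPath → List ℕ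
  runsOf π = let n , ns , _ = ∷ʳE-as-run (proj₂ π) in n ∷ ns

  steps-runsOf : ∀ π → steps π ≡ runs (runsOf π)
  steps-runsOf π = proj₂ (proj₂ (∷ʳE-as-run (proj₂ π)))

∷ʳ≢[] : ∀ {A : Set} (xs : List A) {x} → xs ∷ʳ x ≢ []
∷ʳ≢[] []      ()
∷ʳ≢[] (_ ∷ _) ()

module RunForm (π : EEPath) (ns : List ℕ) (π-runs : steps π ≡ runs ns) where

  x₀ y₀ : ℤ
  x₀ = proj₁ (start π)
  y₀ = proj₂ (start π)

  width : ℕ
  width = length ns

  top : ℕ → ℤ
  top = height y₀ ns

  width-pos : 1 ℕ.≤ width
  width-pos = nonempty ns π-runs
    where
    nonempty : ∀ ms → steps π ≡ runs ms → 1 ℕ.≤ length ms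
    nonempty []      eq = ⊥-elim (∷ʳ≢[] (proj₂ π) eq)
    nonempty (_ ∷ _) _  = s≤s z≤n

  ∈nonSink⇔ : ∀ q → (q ∈ nonSinkPoints π) ⇔ OnRuns (start π) ns q
  ∈nonSink⇔ q = subst (λ ss → (q ∈ nonSinkFrom (start π) ss) ⇔ OnRuns (start π) ns q)
    (sym π-runs) (∈nonSinkFrom-runs ns x₀ y₀ q)

  endPoint≡ : endPoint π ≡ (x₀ + + width , top width)
  endPoint≡ = trans (cong (endFrom (start π)) π-runs) (endFrom-runs ns x₀ y₀)

  start∈nonSink : start π ∈ nonSinkPoints π
  start∈nonSink = proj₂ (∈nonSink⇔ (start π))
    (0 , width-pos , sym (ℤP.+-identityʳ x₀) ,
     subst (top 1 ℤ.≤_) (height-0 y₀ ns) (height-suc≤ y₀ ns 0) ,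
     ℤP.≤-reflexive (sym (height-0 y₀ ns)))

  yInterval : ∀ j → j ℕ.≤ width → YInterval π (x₀ + + j) (top (suc j)) (top j)
  yInterval j j≤w y = to , from
    where
    at-end : top (suc width) ≡ top width
    at-end = height-beyond y₀ ns width ℕP.≤-refl
    to : (x₀ + + j , y) ∈ pathPoints π → top (suc j) ℤ.≤ y × y ℤ.≤ top j
    to m with proj₁ (∈pathPoints⇔ π _) m
    ... | inj₁ m′ with proj₁ (∈nonSink⇔ _) m′
    ... | j′ , _ , eq , lo , hi with +-cancelˡ-ℕ x₀ eq
    ... | refl = lo , hi
    to m | inj₂ eq with +-cancelˡ-ℕ x₀ (,-injectiveˡ (trans eq endPoint≡))
    ... | refl = ℤP.≤-reflexive (trans at-end (sym y≡)) , ℤP.≤-reflexive y≡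
      where
      y≡ : y ≡ top width
      y≡ = ,-injectiveʳ (trans eq endPoint≡)
    from : top (suc j) ℤ.≤ y × y ℤ.≤ top j → (x₀ + + j , y) ∈ pathPoints π
    from (lo , hi) with j ℕP.<? width
    ... | yes j<w = proj₂ (∈pathPoints⇔ π _) (inj₁ (proj₂ (∈nonSink⇔ _) (j , j<w , refl , lo , hi)))
    ... | no j≮w with ℕP.≤-antisym j≤w (ℕP.≮⇒≥ j≮w)
    ... | refl = proj₂ (∈pathPoints⇔ π _) (inj₂ (trans
          (cong (x₀ + + width ,_) (ℤP.≤-antisym hi (subst (ℤ._≤ y) at-end lo))) (sym endPoint≡)))

NonSinkRuns : Point → List ℕ → Point → Set
NonSinkRuns p L q = q ∈ nonSinkFrom p (runs L)

private
  tail-right : ∀ L x z q → NonSinkRuns (x + 1ℤ , z) L q → x + 1ℤ ℤ.≤ proj₁ q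
  tail-right L x z q m with proj₁ (∈nonSinkFrom-runs L (x + 1ℤ) z q) m
  ... | j , _ , eq , _ = subst (x + 1ℤ ℤ.≤_) (sym eq) (x≤x+n (x + 1ℤ) j)

  first-run-≤ : ∀ x y n L n′ L′ →
    (∀ q → NonSinkRuns (x , y) (n ∷ L) q → NonSinkRuns (x , y) (n′ ∷ L′) q) → n ℕ.≤ n′
  first-run-≤ x y n L n′ L′ sub
    with proj₁ (∈nonSinkFrom-run n′ L′ x y (x , y - + n))
               (sub _ (proj₂ (∈nonSinkFrom-run n L x y _) (inj₁ (refl , ℤP.≤-refl , x-n≤x y n))))
  ... | inj₁ (_ , lo , _) = x-n≤x-m⇒m≤n y n n′ lo
  ... | inj₂ m = ⊥-elim (ℤP.<⇒≱ (x<x+1 x) (tail-right L′ x _ _ m))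

  later-runs : ∀ x y n L L′ →
    (∀ q → NonSinkRuns (x , y) (n ∷ L) q → NonSinkRuns (x , y) (n ∷ L′) q) →
    ∀ q → NonSinkRuns (x + 1ℤ , y - + n) L q → NonSinkRuns (x + 1ℤ , y - + n) L′ q
  later-runs x y n L L′ sub q m
    with proj₁ (∈nonSinkFrom-run n L′ x y q) (sub q (proj₂ (∈nonSinkFrom-run n L x y q) (inj₂ m)))
  ... | inj₁ (eq , _) = ⊥-elim (ℤP.<⇒≱ (x<x+1 x) (subst (x + 1ℤ ℤ.≤_) eq (tail-right L x _ q m)))
  ... | inj₂ m′ = m′

runs-determined : ∀ x y L L′ → (∀ q → NonSinkRuns (x , y) L q ⇔ NonSinkRuns (x , y) L′ q) → L ≡ L′
runs-determined x y [] [] same = refl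
runs-determined x y [] (n′ ∷ L′) same
  with proj₂ (same (x , y)) (proj₂ (∈nonSinkFrom-run n′ L′ x y _) (inj₁ (refl , x-n≤x y n′ , ℤP.≤-refl)))
... | ()
runs-determined x y (n ∷ L) [] same
  with proj₁ (same (x , y)) (proj₂ (∈nonSinkFrom-run n L x y _) (inj₁ (refl , x-n≤x y n , ℤP.≤-refl)))
... | ()
runs-determined x y (n ∷ L) (n′ ∷ L′) same
  with ℕP.≤-antisym (first-run-≤ x y n L n′ L′ (λ q → proj₁ (same q)))
                    (first-run-≤ x y n′ L′ n L (λ q → proj₂ (same q)))
... | refl = cong (n ∷_) (runs-determined (x + 1ℤ) (y - + n) L L′ λ q →
    later-runs x y n L L′ (λ q → proj₁ (same q)) q , later-runs x y n L′ L (λ q → proj₂ (same q)) q)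

private
  start-below : ∀ π π′ → start π ∈ nonSinkPoints π′ →
    proj₁ (start π′) ℤ.≤ proj₁ (start π) × proj₂ (start π) ℤ.≤ proj₂ (start π′)
  start-below π π′ m with proj₁ (RunForm.∈nonSink⇔ π′ (runsOf π′) (steps-runsOf π′) (start π)) m
  ... | j , _ , eq , _ , hi =
    subst (proj₁ (start π′) ℤ.≤_) (sym eq) (x≤x+n _ j) , ℤP.≤-trans hi (height-≤start _ (runsOf π′) j)

  nonSink≡runs : ∀ π q → (q ∈ nonSinkPoints π) ≡ NonSinkRuns (start π) (runsOf π) q
  nonSink≡runs π q = cong (λ ss → q ∈ nonSinkFrom (start π) ss) (steps-runsOf π)

path-determined-by-nonSinkPoints : ∀ π π′ →
  (∀ q → (q ∈ nonSinkPoints π) ⇔ (q ∈ nonSinkPoints π′)) → π ≡ π′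
path-determined-by-nonSinkPoints π π′ same = cong₂ _,_ start≡ (proj₁ (LP.∷ʳ-injective (proj₂ π) (proj₂ π′) steps≡))
  where
  start∈ : start π ∈ nonSinkPoints π′
  start∈ = proj₁ (same (start π)) (RunForm.start∈nonSink π (runsOf π) (steps-runsOf π))
  start′∈ : start π′ ∈ nonSinkPoints π
  start′∈ = proj₂ (same (start π′)) (RunForm.start∈nonSink π′ (runsOf π′) (steps-runsOf π′))
  start≡ : start π ≡ start π′
  start≡ = cong₂ _,_ (ℤP.≤-antisym (proj₁ (start-below π′ π start′∈)) (proj₁ (start-below π π′ start∈)))
                     (ℤP.≤-antisym (proj₂ (start-below π π′ start∈)) (proj₂ (start-below π′ π start′∈)))
  same-runs : ∀ q → NonSinkRuns (start π) (runsOf π) q ⇔ NonSinkRuns (start π) (runsOf π′) q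
  same-runs q =
    (λ m → subst (λ p → NonSinkRuns p (runsOf π′) q) (sym start≡)
             (subst id (nonSink≡runs π′ q) (proj₁ (same q) (subst id (sym (nonSink≡runs π q)) m)))) ,
    (λ m → subst id (nonSink≡runs π q) (proj₂ (same q) (subst id (sym (nonSink≡runs π′ q))
             (subst (λ p → NonSinkRuns p (runsOf π′) q) start≡ m))))
  steps≡ : steps π ≡ steps π′
  steps≡ = begin
    steps π              ≡⟨ steps-runsOf π ⟩
    runs (runsOf π)      ≡⟨ cong runs (runs-determined (proj₁ (start π)) (proj₂ (start π)) (runsOf π) (runsOf π′) same-runs) ⟩
    runs (runsOf π′)     ≡⟨ steps-runsOf π′ ⟨
    steps π′             ∎
    where open ≡-Reasoning

bodyOf : List ℕ → List Step
bodyOf []       = []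
bodyOf (n ∷ ns) = runBody n ns

bodyOf-∷ʳ : ∀ L → 1 ℕ.≤ length L → bodyOf L ∷ʳ E ≡ runs L
bodyOf-∷ʳ (n ∷ ns) _ = runBody-∷ʳ n ns

dropsOf : (ℕ → ℤ) → ℕ → List ℕ
dropsOf H zero    = []
dropsOf H (suc m) = ℤ.∣ H 0 - H 1 ∣ ∷ dropsOf (H ∘ suc) m

length-dropsOf : ∀ H m → length (dropsOf H m) ≡ m
length-dropsOf H zero    = refl
length-dropsOf H (suc m) = cong suc (length-dropsOf (H ∘ suc) m)

height-dropsOf : ∀ H m → (∀ j → j ℕ.< m → H (suc j) ℤ.≤ H j) →
                 ∀ j → j ℕ.≤ m → height (H 0) (dropsOf H m) j ≡ H j
height-dropsOf H m       H↓ zero    _          = height-0 (H 0) (dropsOf H m)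
height-dropsOf H (suc m) H↓ (suc j) (s≤s j≤m) = begin
  height (H 0 - + ℤ.∣ H 0 - H 1 ∣) (dropsOf (H ∘ suc) m) j
    ≡⟨ cong (λ y → height y (dropsOf (H ∘ suc) m) j) H0-drop≡H1 ⟩
  height (H 1) (dropsOf (H ∘ suc) m) j
    ≡⟨ height-dropsOf (H ∘ suc) m (λ j j<m → H↓ (suc j) (s≤s j<m)) j j≤m ⟩
  H (suc j) ∎
  where
  open ≡-Reasoning
  ring : ∀ a b → a - (a - b) ≡ b
  ring = solve-∀
  H0-drop≡H1 : H 0 - + ℤ.∣ H 0 - H 1 ∣ ≡ H 1
  H0-drop≡H1 = trans (cong (λ w → H 0 - w) (ℤP.0≤i⇒+∣i∣≡i (≤⇒diff (H↓ 0 (s≤s z≤n))))) (ring (H 0) (H 1))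

yInterval-unique : ∀ {π x a b v w} → a ℤ.≤ b → YInterval π x a b → YInterval π x v w → v ≡ a × w ≡ b
yInterval-unique {a = a} {b} {v} {w} a≤b Y Y′ = sym (interval-lower-unique a≤b same) , sym (interval-upper-unique a≤b same)
  where
  same : ∀ y → (a ℤ.≤ y × y ℤ.≤ b) ⇔ (v ℤ.≤ y × y ℤ.≤ w)
  same = λ y → (λ y∈ → proj₁ (Y′ y) (proj₂ (Y y) y∈)) , (λ y∈ → proj₁ (Y y) (proj₂ (Y′ y) y∈))

module _ {r : ℕ} (σ : Fin r → ℤ)
  (σ-increasing : ∀ k l → toℕ k ℕ.< toℕ l → σ k ℤ.< σ l)
  (σ-positive : ∀ f → 1ℤ ℤ.≤ σ f)
  (σ-downClosed : ∀ f v → 1ℤ ℤ.≤ v → v ℤ.≤ σ f → ∃ λ f′ → σ f′ ≡ v)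
  where

  private
    RanksBelow : ℕ → Set
    RanksBelow n = ∀ {m} → m ℕ.< n → ∀ f → toℕ f ≡ m → σ f ≡ + suc m

    rank-lower : ∀ n → RanksBelow n → ∀ f → toℕ f ≡ n → + suc n ℤ.≤ σ f
    rank-lower zero    _  f _  = σ-positive f
    rank-lower (suc n) ih f f≡ = ℤP.i<j⇒suc[i]≤j (subst (ℤ._< σ f) (ih ℕP.≤-refl f′ (FinP.toℕ-fromℕ< n<r))
      (σ-increasing f′ f (subst₂ ℕ._<_ (sym (FinP.toℕ-fromℕ< n<r)) (sym f≡) ℕP.≤-refl)))
      where
      n<r : n ℕ.< r
      n<r = ℕP.<-trans (ℕP.≤-reflexive (sym f≡)) (FinP.toℕ<n f)
      f′ : Fin r
      f′ = Fin.fromℕ< n<r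

    rank-upper : ∀ n → RanksBelow n → ∀ f → toℕ f ≡ n → σ f ℤ.≤ + suc n
    rank-upper n ih f f≡ with σ f ℤP.≤? + suc n
    ... | yes le = le
    ... | no ≰ with σ-downClosed f (+ suc n) (ℤ.+≤+ (s≤s z≤n)) (ℤP.<⇒≤ (ℤP.≰⇒> ≰))
    ... | f′ , σf′≡ with ℕP.<-cmp (toℕ f′) n
    ... | tri< lt _ _ = ⊥-elim (ℕP.<-irrefl (ℕP.suc-injective (ℤP.+-injective (trans (sym (ih lt f′ refl)) σf′≡))) lt)
    ... | tri≈ _ eq _ = ⊥-elim (≰ (ℤP.≤-reflexive (trans (cong σ (FinP.toℕ-injective (trans f≡ (sym eq)))) σf′≡)))
    ... | tri> _ _ gt = ⊥-elim (ℤP.<-asym (σ-increasing f f′ (subst (ℕ._< toℕ f′) (sym f≡) gt))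
                                          (subst (ℤ._< σ f) (sym σf′≡) (ℤP.≰⇒> ≰)))

  consecutive-ranks : ∀ f → σ f ≡ + suc (toℕ f)
  consecutive-ranks f = <-rec (λ n → ∀ f → toℕ f ≡ n → σ f ≡ + suc n)
    (λ n ih f f≡ → ℤP.≤-antisym (rank-upper n ih f f≡) (rank-lower n ih f f≡)) (toℕ f) f refl

≡-by-lookup : ∀ {A : Set} (xs ys : List A) (eq : length xs ≡ length ys) →
              (∀ f → lookup xs f ≡ lookup ys (Fin.cast eq f)) → xs ≡ ys
≡-by-lookup []       []       eq same = refl
≡-by-lookup (x ∷ xs) (y ∷ ys) eq same =
  cong₂ _∷_ (same Fin.zero) (≡-by-lookup xs ys (ℕP.suc-injective eq) (λ f → same (Fin.suc f)))

entry-beyond : ∀ xs i → length xs ℕ.< i → entry xs i ≡ 0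
entry-beyond []       zero          _         = refl
entry-beyond []       (suc i)       _         = refl
entry-beyond (x ∷ xs) (suc zero)    (s≤s ())
entry-beyond (x ∷ xs) (suc (suc i)) (s≤s le) = entry-beyond xs (suc i) le

≡-by-entry : ∀ xs ys → All (ℕ._<_ 0) xs → All (ℕ._<_ 0) ys →
             (∀ i → entry xs (suc i) ≡ entry ys (suc i)) → xs ≡ ys
≡-by-entry []       []       _        _        same = refl
≡-by-entry []       (y ∷ ys) _        (y>0 ∷ _) same = ⊥-elim (ℕP.<-irrefl (same 0) y>0)
≡-by-entry (x ∷ xs) []       (x>0 ∷ _) _       same = ⊥-elim (ℕP.<-irrefl (sym (same 0)) x>0)
≡-by-entry (x ∷ xs) (y ∷ ys) (_ ∷ xs>0) (_ ∷ ys>0) same =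
  cong₂ _∷_ (same 0) (≡-by-entry xs ys xs>0 ys>0 (λ i → same (suc i)))

entry-antitone : ∀ xs → Linked ℕ._≥_ xs → ∀ {i j} → i ℕ.≤ j → entry xs (suc j) ℕ.≤ entry xs (suc i)
entry-antitone xs xs↓ {i} i≤j with ℕP.m≤n⇒∃[o]m+o≡n i≤j
... | o , refl = go xs xs↓ i o
  where
  step : ∀ xs → Linked ℕ._≥_ xs → ∀ j → entry xs (suc (suc j)) ℕ.≤ entry xs (suc j)
  step []           _        j       = z≤n
  step (x ∷ [])     _        j       = z≤n
  step (x ∷ y ∷ ys) (y≤x ∷ _) zero    = y≤x
  step (x ∷ y ∷ ys) (_ ∷ ↓)   (suc j) = step (y ∷ ys) ↓ j
  go : ∀ xs → Linked ℕ._≥_ xs → ∀ i o → entry xs (suc (i ℕ.+ o)) ℕ.≤ entry xs (suc i)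
  go xs ↓ i zero    = ℕP.≤-reflexive (cong (λ k → entry xs (suc k)) (ℕP.+-identityʳ i))
  go xs ↓ i (suc o) = subst (λ k → entry xs (suc k) ℕ.≤ entry xs (suc i)) (sym (ℕP.+-suc i o))
    (ℕP.≤-trans (step xs ↓ (i ℕ.+ o)) (go xs ↓ i o))

shift : (ℕ → ℕ) → ℕ → ℕ
shift w j = w (suc j)

positivePrefix : (ℕ → ℕ) → ℕ → List ℕ
positivePrefix w zero = []
positivePrefix w (suc n) with w 1
... | zero  = []
... | suc x = suc x ∷ positivePrefix (shift w) n

Antitone₁ : (ℕ → ℕ) → Set
Antitone₁ w = ∀ j → w (suc (suc j)) ℕ.≤ w (suc j)

private
  antitone-≤w1 : ∀ w → Antitone₁ w → ∀ i → w (suc i) ℕ.≤ w 1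
  antitone-≤w1 w w↓ zero    = ℕP.≤-refl
  antitone-≤w1 w w↓ (suc i) = ℕP.≤-trans (w↓ i) (antitone-≤w1 w w↓ i)

  positivePrefix-head : ∀ w n y ys → positivePrefix w n ≡ y ∷ ys → y ≡ w 1
  positivePrefix-head w (suc n) y ys eq with w 1
  positivePrefix-head w (suc n) y ys refl | suc x = refl

entry-positivePrefix : ∀ w n → Antitone₁ w → (∀ j → n ℕ.< j → w j ≡ 0) →
                       ∀ i → entry (positivePrefix w n) (suc i) ≡ w (suc i)
entry-positivePrefix w zero w↓ w0 i = sym (w0 (suc i) (s≤s z≤n))
entry-positivePrefix w (suc n) w↓ w0 i with w 1 in w1≡
... | zero = sym (ℕP.n≤0⇒n≡0 (subst (w (suc i) ℕ.≤_) w1≡ (antitone-≤w1 w w↓ i)))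
entry-positivePrefix w (suc n) w↓ w0 zero    | suc x = sym w1≡
entry-positivePrefix w (suc n) w↓ w0 (suc i) | suc x =
  entry-positivePrefix (shift w) n (λ j → w↓ (suc j)) (λ j lt → w0 (suc j) (s≤s lt)) i

positivePrefix-linked : ∀ w n → Antitone₁ w → Linked ℕ._≥_ (positivePrefix w n)
positivePrefix-linked w zero w↓ = []
positivePrefix-linked w (suc n) w↓ with w 1 in w1≡
... | zero = []
... | suc x with positivePrefix (shift w) n in rest≡ | positivePrefix-linked (shift w) n (λ j → w↓ (suc j))
...   | []     | _ = [-]
...   | y ∷ ys | ↓ = subst (y ℕ.≤_) w1≡
  (subst (ℕ._≤ w 1) (sym (positivePrefix-head (shift w) n y ys rest≡)) (w↓ 0)) ∷ ↓

positivePrefix-positive : ∀ w n → All (ℕ._<_ 0) (positivePrefix w n)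
positivePrefix-positive w zero = []
positivePrefix-positive w (suc n) with w 1
... | zero  = []
... | suc x = s≤s z≤n ∷ positivePrefix-positive (shift w) n

length-positivePrefix≤ : ∀ w n → length (positivePrefix w n) ℕ.≤ n
length-positivePrefix≤ w zero = z≤n
length-positivePrefix≤ w (suc n) with w 1
... | zero  = z≤n
... | suc x = s≤s (length-positivePrefix≤ (shift w) n)

length-positivePrefix≤zero : ∀ w n j → w (suc j) ≡ 0 → length (positivePrefix w n) ℕ.≤ j
length-positivePrefix≤zero w zero j _ = z≤n
length-positivePrefix≤zero w (suc n) j wj≡0 with w 1 in w1≡
... | zero = z≤n
length-positivePrefix≤zero w (suc n) zero    wj≡0 | suc x = ⊥-elim (ℕP.0≢1+n (trans (sym wj≡0) w1≡))
length-positivePrefix≤zero w (suc n) (suc j) wj≡0 | suc x = s≤s (length-positivePrefix≤zero (shift w) n j wj≡0)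

lamExt-inner : ∀ h lam k → suc k ℕ.< h → lamExt h lam (suc k) ≡ lam (suc k)
lamExt-inner h lam k lt with h ℕP.≤? suc k
... | yes ge = ⊥-elim (ℕP.<⇒≱ lt ge)
... | no _   = refl

lamExt-outer : ∀ h lam k → h ℕ.≤ suc k → lamExt h lam (suc k) ≡ []
lamExt-outer h lam k ge with h ℕP.≤? suc k
... | yes _ = refl
... | no ≱  = ⊥-elim (≱ ge)

-- The sequence g of a den

module Den (h : ℕ) (p : IrrationalCut) (d e : ℕ → ℤ) (den : IsDen h p d e) where

  open IrrationalCut p

  g : ℕ → ℤ
  g = gseq d e

  δ : ℕ → ℤ
  δ k = d k - e k

  u : ℕ → ℤ
  u k = e k - g k

  d≡u+g : ∀ k → d k ≡ u k + g (suc k)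
  d≡u+g k = ring (d k) (e k) (g k)
    where
    ring : ∀ d e g → d ≡ e - g + (g + (d - e))
    ring = solve-∀

  1≤h : 1 ℕ.≤ h
  1≤h = proj₁ den

  g-end : g (suc h) ≡ 0ℤ
  g-end = begin
    sumTo δ (suc h)                      ≡⟨ sumTo-diff (suc h) ⟩
    sumTo d (suc h) - sumTo e (suc h)    ≡⟨ cong (_- sumTo e (suc h)) sums≡ ⟩
    sumTo e (suc h) - sumTo e (suc h)    ≡⟨ ℤP.+-inverseʳ (sumTo e (suc h)) ⟩
    0ℤ                                   ∎
    where
    open ≡-Reasoning
    sums≡ : sumTo d (suc h) ≡ sumTo e (suc h)
    sums≡ = proj₂ (proj₂ (proj₂ (proj₂ (proj₂ den))))
    sumTo-diff : ∀ n → sumTo δ n ≡ sumTo d n - sumTo e n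
    sumTo-diff zero    = refl
    sumTo-diff (suc n) = trans (cong (_+ δ n) (sumTo-diff n)) (ring (sumTo d n) (sumTo e n) (d n) (e n))
      where
      ring : ∀ a b c d → a - b + (c - d) ≡ a + c - (b + d)
      ring = solve-∀

  δ-first : 0ℤ ℤ.< δ 0
  δ-first = <-byDiff (ring (d 0) (e 0)) (<⇒diff (proj₁ (proj₂ (proj₂ (proj₂ den)))))
    where
    ring : ∀ d e → d - e - (1ℤ + 0ℤ) ≡ d - (1ℤ + e)
    ring = solve-∀

  δ-last : δ h ℤ.< 0ℤ
  δ-last = <-byDiff (ring (d h) (e h)) (<⇒diff (proj₁ (proj₂ (proj₂ (proj₂ (proj₂ den))))))
    where
    ring : ∀ d e → 0ℤ - (1ℤ + (d - e)) ≡ e - (1ℤ + d)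
    ring = solve-∀

  private
    /-mono-≤ : ∀ a b m → b ℤ.≤ a → (b ℚ./ suc m) ℚ.≤ (a ℚ./ suc m)
    /-mono-≤ a b m b≤a = ℚP.toℚᵘ-cancel-≤
      (ℚᵘP.≤-respʳ-≃ (ℚᵘP.≃-sym (ℚP.toℚᵘ-fromℚᵘ (ℚᵘ.mkℚᵘ a m)))
        (ℚᵘP.≤-respˡ-≃ (ℚᵘP.≃-sym (ℚP.toℚᵘ-fromℚᵘ (ℚᵘ.mkℚᵘ b m)))
          (ℚᵘ.*≤* (ℤP.*-monoʳ-≤-nonNeg (+ suc m) b≤a))))

    below-cut<above-cut : ∀ a b m → L (a ℚ./ suc m) → U (b ℚ./ suc m) → a ℤ.< b
    below-cut<above-cut a b m la ub with b ℤP.≤? a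
    ... | yes b≤a = ⊥-elim (disjoint (L-down (/-mono-≤ a b m b≤a) la) ub)
    ... | no b≰a  = ℤP.≰⇒> b≰a

  -- The two slope conditions of the den squeeze the irrational p, which gives δ_j < δ_i + 2.
  δ-slowly-rising : ∀ i m → 1 ℕ.≤ i → i ℕ.+ suc m ℕ.≤ h ∸ 1 → δ (i ℕ.+ suc m) ℤ.≤ δ i + 1ℤ
  δ-slowly-rising i m 1≤i j≤h-1 = ≤-byDiff (ring (d i) (d j) (e i) (e j)) (<⇒diff squeezed)
    where
    j : ℕ
    j = i ℕ.+ suc m
    squeezed : e i - e j - 1ℤ ℤ.< d i - d j + 1ℤ
    squeezed = below-cut<above-cut (e i - e j - 1ℤ) (d i - d j + 1ℤ) m
      (proj₁ (proj₂ (proj₂ den)) i m 1≤i (ℕP.≤-trans j≤h-1 (ℕP.m∸n≤m h 1)))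
      (proj₁ (proj₂ den) i m j≤h-1)
    ring : ∀ di dj ei ej → di - ei + 1ℤ - (dj - ej) ≡ di - dj + 1ℤ - (1ℤ + (ei - ej - 1ℤ))
    ring = solve-∀

  δ-pos⇒earlier-nonneg : ∀ a b → a ℕ.< b → b ℕ.≤ h → 0ℤ ℤ.< δ b → 0ℤ ℤ.≤ δ a
  δ-pos⇒earlier-nonneg a b a<b b≤h δb>0 with b ℕP.≟ h
  ... | yes refl = ⊥-elim (ℤP.<-asym δb>0 δ-last)
  δ-pos⇒earlier-nonneg zero     b a<b b≤h δb>0 | no b≢h = ℤP.<⇒≤ δ-first
  δ-pos⇒earlier-nonneg (suc a′) b a<b b≤h δb>0 | no b≢h with ℕP.m≤n⇒∃[o]m+o≡n a<b
  ... | o , eq = ≤-byDiff (ring (δ (suc a′)) (δ b)) (+-nonneg (≤⇒diff rising) (<⇒diff δb>0))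
    where
    a+1+o≡b : suc a′ ℕ.+ suc o ≡ b
    a+1+o≡b = trans (ℕP.+-suc (suc a′) o) eq
    b≤h-1 : b ℕ.≤ h ∸ 1
    b≤h-1 = m<n⇒m≤n∸1 (ℕP.≤∧≢⇒< b≤h b≢h)
    rising : δ b ℤ.≤ δ (suc a′) + 1ℤ
    rising = subst (λ c → δ c ℤ.≤ δ (suc a′) + 1ℤ) a+1+o≡b
      (δ-slowly-rising (suc a′) o (s≤s z≤n) (subst (ℕ._≤ h ∸ 1) (sym a+1+o≡b) b≤h-1))
    ring : ∀ x y → x - 0ℤ ≡ x + 1ℤ - y + (y - (1ℤ + 0ℤ))
    ring = solve-∀

  δ-neg⇒later-nonpos : ∀ a b → a ℕ.≤ b → b ℕ.≤ h → δ a ℤ.< 0ℤ → δ b ℤ.≤ 0ℤ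
  δ-neg⇒later-nonpos a b a≤b b≤h δa<0 with δ b ℤP.≤? 0ℤ | a ℕP.≟ b
  ... | yes δb≤0 | _        = δb≤0
  ... | no _     | yes refl = ℤP.<⇒≤ δa<0
  ... | no δb≰0  | no a≢b   =
    ⊥-elim (ℤP.<⇒≱ δa<0 (δ-pos⇒earlier-nonneg a b (ℕP.≤∧≢⇒< a≤b a≢b) b≤h (ℤP.≰⇒> δb≰0)))

  g-step-up : ∀ k → 0ℤ ℤ.≤ δ k → g k ℤ.≤ g (suc k)
  g-step-up k δk≥0 = ≤-byDiff (ring (g k) (δ k)) δk≥0
    where
    ring : ∀ x y → x + y - x ≡ y
    ring = solve-∀

  g-step-down : ∀ k → δ k ℤ.≤ 0ℤ → g (suc k) ℤ.≤ g k
  g-step-down k δk≤0 = ≤-byDiff (ring (g k) (δ k)) (≤⇒diff δk≤0)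
    where
    ring : ∀ x y → x - (x + y) ≡ 0ℤ - y
    ring = solve-∀

  g-rises⇒δ-pos : ∀ k → g k ℤ.< g (suc k) → 0ℤ ℤ.< δ k
  g-rises⇒δ-pos k lt = <-byDiff (ring (g k) (δ k)) (<⇒diff lt)
    where
    ring : ∀ x y → y - (1ℤ + 0ℤ) ≡ x + y - (1ℤ + x)
    ring = solve-∀

  g-falls⇒δ-neg : ∀ k → g (suc k) ℤ.< g k → δ k ℤ.< 0ℤ
  g-falls⇒δ-neg k lt = <-byDiff (ring (g k) (δ k)) (<⇒diff lt)
    where
    ring : ∀ x y → 0ℤ - (1ℤ + y) ≡ x - (1ℤ + (x + y))
    ring = solve-∀

  g-monotone-up : ∀ a b → a ℕ.≤ b → (∀ c → a ℕ.≤ c → c ℕ.< b → 0ℤ ℤ.≤ δ c) → g a ℤ.≤ g b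
  g-monotone-up a zero    z≤n _    = ℤP.≤-refl
  g-monotone-up a (suc b) a≤b+1 up with a ℕP.≤? b
  ... | yes a≤b = ℤP.≤-trans (g-monotone-up a b a≤b (λ c a≤c c<b → up c a≤c (ℕP.m≤n⇒m≤1+n c<b)))
                             (g-step-up b (up b a≤b ℕP.≤-refl))
  ... | no a≰b with ℕP.≤-antisym a≤b+1 (ℕP.≰⇒> a≰b)
  ... | refl = ℤP.≤-refl

  g-monotone-down : ∀ a b → a ℕ.≤ b → (∀ c → a ℕ.≤ c → c ℕ.< b → δ c ℤ.≤ 0ℤ) → g b ℤ.≤ g a
  g-monotone-down a zero    z≤n _      = ℤP.≤-refl
  g-monotone-down a (suc b) a≤b+1 down with a ℕP.≤? b
  ... | yes a≤b = ℤP.≤-trans (g-step-down b (down b a≤b ℕP.≤-refl))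
                             (g-monotone-down a b a≤b (λ c a≤c c<b → down c a≤c (ℕP.m≤n⇒m≤1+n c<b)))
  ... | no a≰b with ℕP.≤-antisym a≤b+1 (ℕP.≰⇒> a≰b)
  ... | refl = ℤP.≤-refl

  g-rising-before : ∀ a b s → a ℕ.≤ b → b ℕ.≤ s → s ℕ.≤ h → 0ℤ ℤ.< δ s → g a ℤ.≤ g b
  g-rising-before a b s a≤b b≤s s≤h δs>0 = g-monotone-up a b a≤b λ c _ c<b →
    δ-pos⇒earlier-nonneg c s (ℕP.<-≤-trans c<b b≤s) s≤h δs>0

  g-falling-after : ∀ t a b → t ℕ.≤ a → a ℕ.≤ b → b ℕ.≤ suc h → δ t ℤ.< 0ℤ → g b ℤ.≤ g a
  g-falling-after t a b t≤a a≤b b≤h+1 δt<0 = g-monotone-down a b a≤b λ c a≤c c<b →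
    δ-neg⇒later-nonpos t c (ℕP.≤-trans t≤a a≤c) (ℕP.≤-pred (ℕP.<-≤-trans c<b b≤h+1)) δt<0

  private
    negative-δ-or-rising : ∀ a b → a ℕ.≤ b →
      (∃ λ j → a ℕ.≤ j × j ℕ.< b × δ j ℤ.< 0ℤ) ⊎ (∀ c → a ℕ.≤ c → c ℕ.< b → 0ℤ ℤ.≤ δ c)
    negative-δ-or-rising a zero    z≤n = inj₂ λ c _ ()
    negative-δ-or-rising a (suc b) a≤b+1 with a ℕP.≤? b
    ... | no a≰b = inj₂ λ c a≤c c<b+1 → ⊥-elim (ℕP.<⇒≱ c<b+1 (ℕP.≤-trans (ℕP.≰⇒> a≰b) a≤c))
    ... | yes a≤b with negative-δ-or-rising a b a≤b
    ...   | inj₁ (j , a≤j , j<b , δj<0) = inj₁ (j , a≤j , ℕP.m≤n⇒m≤1+n j<b , δj<0)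
    ...   | inj₂ up with 0ℤ ℤP.≤? δ b
    ...     | no δb≱0  = inj₁ (b , a≤b , ℕP.≤-refl , ℤP.≰⇒> δb≱0)
    ...     | yes δb≥0 = inj₂ λ c a≤c c<b+1 → [ (λ c<b → up c a≤c c<b) , (λ { refl → δb≥0 }) ]′
                                               (ℕP.m<1+n⇒m<n∨m≡n c<b+1)

  g-superlevel-convex : ∀ i a b c → a ℕ.≤ b → b ℕ.≤ c → c ℕ.≤ suc h →
    i ℤ.≤ g a → i ℤ.≤ g c → i ℤ.≤ g b
  g-superlevel-convex i a b c a≤b b≤c c≤h+1 i≤ga i≤gc with negative-δ-or-rising a b a≤b
  ... | inj₂ up = ℤP.≤-trans i≤ga (g-monotone-up a b a≤b up)
  ... | inj₁ (j , _ , j<b , δj<0) = ℤP.≤-trans i≤gc (g-falling-after j b c (ℕP.<⇒≤ j<b) b≤c c≤h+1 δj<0)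

  g-positive : ∀ k → 1 ℕ.≤ k → k ℕ.≤ h → 1ℤ ℤ.≤ g k
  g-positive k 1≤k k≤h =
    g-superlevel-convex 1ℤ 1 k h 1≤k k≤h (ℕP.n≤1+n h) (ℤP.i<j⇒suc[i]≤j g1>0) gh≥1
    where
    g1>0 : 0ℤ ℤ.< g 1
    g1>0 = subst (0ℤ ℤ.<_) (sym (ℤP.+-identityˡ (δ 0))) δ-first
    gh≥1 : 1ℤ ℤ.≤ g h
    gh≥1 = ≤-byDiff (ring (g h) (δ h)) (+-nonneg (<⇒diff δ-last) (ℤP.≤-reflexive (sym g-end)))
      where
      ring : ∀ x y → x - 1ℤ ≡ 0ℤ - (1ℤ + y) + (x + y)
      ring = solve-∀

  g-nonneg : ∀ k → k ℕ.≤ suc h → 0ℤ ℤ.≤ g k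
  g-nonneg zero    _ = ℤP.≤-refl
  g-nonneg (suc k) k<h+1 with suc k ℕP.≤? h
  ... | yes k<h = ℤP.≤-trans (ℤ.+≤+ z≤n) (g-positive (suc k) (s≤s z≤n) k<h)
  ... | no k≮h  = ℤP.≤-reflexive (sym (trans (cong g (ℕP.≤-antisym k<h+1 (ℕP.≰⇒> k≮h))) g-end))

  crossing-up : ∀ v c → 0ℤ ℤ.< v → v ℤ.≤ g c → ∃ λ a → a ℕ.< c × g a ℤ.< v × v ℤ.≤ g (suc a)
  crossing-up v zero    v>0 v≤g0 = ⊥-elim (ℤP.<⇒≱ v>0 v≤g0)
  crossing-up v (suc c) v>0 v≤g with v ℤP.≤? g c
  ... | yes v≤gc = let a , a<c , rest = crossing-up v c v>0 v≤gc in a , ℕP.m≤n⇒m≤1+n a<c , rest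
  ... | no v≰gc  = c , ℕP.≤-refl , ℤP.≰⇒> v≰gc , v≤g

  crossing-down : ∀ v a → 0ℤ ℤ.< v → a ℕ.≤ suc h → v ℤ.≤ g a →
                  ∃ λ b → a ℕ.≤ b × b ℕ.≤ h × g (suc b) ℤ.< v × v ℤ.≤ g b
  crossing-down v a v>0 a≤h+1 v≤ga = go (suc h ∸ a) a (ℕP.m∸n+n≡m a≤h+1) v≤ga
    where
    go : ∀ n a → n ℕ.+ a ≡ suc h → v ℤ.≤ g a → ∃ λ b → a ℕ.≤ b × b ℕ.≤ h × g (suc b) ℤ.< v × v ℤ.≤ g b
    go zero    a refl v≤ga = ⊥-elim (ℤP.<⇒≱ v>0 (subst (v ℤ.≤_) g-end v≤ga))
    go (suc n) a eq   v≤ga with v ℤP.≤? g (suc a)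
    ... | no v≰ = a , ℕP.≤-refl , ℕP.≤-trans (ℕP.m≤n+m a n) (ℕP.≤-reflexive (ℕP.suc-injective eq)) ,
                  ℤP.≰⇒> v≰ , v≤ga
    ... | yes v≤ = let b , a<b , rest = go n (suc a) (trans (ℕP.+-suc n a) eq) v≤ in b , ℕP.<⇒≤ a<b , rest

  -- The rank of the lattice point (c , y) is y − u c.
  source⇒rank : ∀ c y → e c ℤ.< y → y ℤ.≤ d c → g c ℤ.< y - u c × y - u c ℤ.≤ g (suc c)
  source⇒rank c y e<y y≤d = <-byDiff (ring₁ (e c) (g c) y) (<⇒diff e<y) , ≤-byDiff (ring₂ (d c) (e c) (g c) y) (≤⇒diff y≤d)
    where
    ring₁ : ∀ e g y → y - (e - g) - (1ℤ + g) ≡ y - (1ℤ + e)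
    ring₁ = solve-∀
    ring₂ : ∀ d e g y → g + (d - e) - (y - (e - g)) ≡ d - y
    ring₂ = solve-∀

  rank⇒source : ∀ c v → g c ℤ.< v → v ℤ.≤ g (suc c) → e c ℤ.< u c + v × u c + v ℤ.≤ d c
  rank⇒source c v g<v v≤g = <-byDiff (ring₁ (e c) (g c) v) (<⇒diff g<v) , ≤-byDiff (ring₂ (d c) (e c) (g c) v) (≤⇒diff v≤g)
    where
    ring₁ : ∀ e g v → e - g + v - (1ℤ + e) ≡ v - (1ℤ + g)
    ring₁ = solve-∀
    ring₂ : ∀ d e g v → d - (e - g + v) ≡ g + (d - e) - v
    ring₂ = solve-∀

  sink⇒rank : ∀ c y → d c ℤ.< y → y ℤ.≤ e c → g (suc c) ℤ.< y - u c × y - u c ℤ.≤ g c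
  sink⇒rank c y d<y y≤e = <-byDiff (ring₁ (d c) (e c) (g c) y) (<⇒diff d<y) , ≤-byDiff (ring₂ (e c) (g c) y) (≤⇒diff y≤e)
    where
    ring₁ : ∀ d e g y → y - (e - g) - (1ℤ + (g + (d - e))) ≡ y - (1ℤ + d)
    ring₁ = solve-∀
    ring₂ : ∀ e g y → g - (y - (e - g)) ≡ e - y
    ring₂ = solve-∀

  rank⇒sink : ∀ c v → g (suc c) ℤ.< v → v ℤ.≤ g c → d c ℤ.< u c + v × u c + v ℤ.≤ e c
  rank⇒sink c v g<v v≤g = <-byDiff (ring₁ (d c) (e c) (g c) v) (<⇒diff g<v) , ≤-byDiff (ring₂ (e c) (g c) v) (≤⇒diff v≤g)
    where
    ring₁ : ∀ d e g v → e - g + v - (1ℤ + d) ≡ v - (1ℤ + (g + (d - e)))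
    ring₁ = solve-∀
    ring₂ : ∀ e g v → e - (e - g + v) ≡ g - v
    ring₂ = solve-∀

  u+v-u≡v : ∀ c v → u c + v - u c ≡ v
  u+v-u≡v c v = ring (u c) v
    where
    ring : ∀ a v → a + v - a ≡ v
    ring = solve-∀

  y≡u+[y-u] : ∀ c y → y ≡ u c + (y - u c)
  y≡u+[y-u] c y = ring (u c) y
    where
    ring : ∀ a y → y ≡ a + (y - a)
    ring = solve-∀

  column-range⇔ : ∀ i s t → s ℕ.≤ h → t ℕ.≤ h →
    g s ℤ.< i → i ℤ.≤ g (suc s) → g (suc t) ℤ.< i → i ℤ.≤ g t →
    ∀ c → c ℕ.< h → (s ℕ.≤ c × c ℕ.< t) ⇔ (i ℤ.≤ g (suc c))
  column-range⇔ i s t s≤h t≤h g<i i≤g g′<i i≤g′ c c<h = to , from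
    where
    δs>0 : 0ℤ ℤ.< δ s
    δs>0 = g-rises⇒δ-pos s (ℤP.<-≤-trans g<i i≤g)
    δt<0 : δ t ℤ.< 0ℤ
    δt<0 = g-falls⇒δ-neg t (ℤP.<-≤-trans g′<i i≤g′)
    to : s ℕ.≤ c × c ℕ.< t → i ℤ.≤ g (suc c)
    to (s≤c , c<t) = g-superlevel-convex i (suc s) (suc c) t (s≤s s≤c) c<t (ℕP.m≤n⇒m≤1+n t≤h) i≤g i≤g′
    from : i ℤ.≤ g (suc c) → s ℕ.≤ c × c ℕ.< t
    from i≤gc with s ℕP.≤? c | suc c ℕP.≤? t
    ... | yes s≤c | yes c<t = s≤c , c<t
    ... | no s≰c  | _       = ⊥-elim (ℤP.<⇒≱ g<i
          (ℤP.≤-trans i≤gc (g-rising-before (suc c) s s (ℕP.≰⇒> s≰c) ℕP.≤-refl s≤h δs>0)))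
    ... | yes _   | no c≮t  = ⊥-elim (ℤP.<⇒≱ g′<i (ℤP.≤-trans i≤gc
          (g-falling-after t (suc t) (suc c) (ℕP.n≤1+n _) (s≤s (ℕP.≤-pred (ℕP.≰⇒> c≮t))) (s≤s (ℕP.<⇒≤ c<h)) δt<0)))

  ascent-unique : ∀ i a b → a ℕ.≤ h → b ℕ.≤ h → g a ℤ.< i → i ℤ.≤ g (suc a) → g b ℤ.< i → i ℤ.≤ g (suc b) → a ≡ b
  ascent-unique i a b a≤h b≤h ga<i i≤ga gb<i i≤gb with ℕP.<-cmp a b
  ... | tri≈ _ a≡b _ = a≡b
  ... | tri< a<b _ _ = ⊥-elim (ℤP.<⇒≱ gb<i (ℤP.≤-trans i≤ga
          (g-rising-before (suc a) b b a<b ℕP.≤-refl b≤h (g-rises⇒δ-pos b (ℤP.<-≤-trans gb<i i≤gb)))))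
  ... | tri> _ _ b<a = ⊥-elim (ℤP.<⇒≱ ga<i (ℤP.≤-trans i≤gb
          (g-rising-before (suc b) a a b<a ℕP.≤-refl a≤h (g-rises⇒δ-pos a (ℤP.<-≤-trans ga<i i≤ga)))))

  descent-unique : ∀ i a b → a ℕ.≤ h → b ℕ.≤ h → g (suc a) ℤ.< i → i ℤ.≤ g a → g (suc b) ℤ.< i → i ℤ.≤ g b → a ≡ b
  descent-unique i a b a≤h b≤h ga<i i≤ga gb<i i≤gb with ℕP.<-cmp a b
  ... | tri≈ _ a≡b _ = a≡b
  ... | tri< a<b _ _ = ⊥-elim (ℤP.<⇒≱ ga<i (ℤP.≤-trans i≤gb
          (g-falling-after a (suc a) b (ℕP.n≤1+n a) a<b (ℕP.m≤n⇒m≤1+n b≤h) (g-falls⇒δ-neg a (ℤP.<-≤-trans ga<i i≤ga)))))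
  ... | tri> _ _ b<a = ⊥-elim (ℤP.<⇒≱ gb<i (ℤP.≤-trans i≤ga
          (g-falling-after b (suc b) a (ℕP.n≤1+n b) b<a (ℕP.m≤n⇒m≤1+n a≤h) (g-falls⇒δ-neg b (ℤP.<-≤-trans gb<i i≤gb)))))

  OnIntervals : (ℕ → List ℕ) → ℕ → Point → Set
  OnIntervals lam i (x , y) = ∃ λ c → x ≡ + c × c ℕ.< h × + i ℤ.≤ g (suc c) ×
    Ilo h d e lam c i ℤ.≤ y × y ℤ.≤ Ihi h d e lam c i

-- Part (i): the shape of a nest

module Nest (h : ℕ) (p : IrrationalCut) (d e : ℕ → ℤ) (den : IsDen h p d e)
  (πs : List EEPath) (nest : IsNest h d e πs) where

  open Den h p d e den

  r : ℕ
  r = length πs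

  P : Fin r → EEPath
  P = lookup πs

  module Run (f : Fin r) = RunForm (P f) (runsOf (P f)) (steps-runsOf (P f))

  starts-source : ∀ f → IsSource h d e (start (P f))
  starts-source = proj₁ nest

  source-start : ∀ pt → IsSource h d e pt → ∃ λ f → start (P f) ≡ pt
  source-start = proj₁ (proj₂ nest)

  ends-sink : ∀ f → IsSink h d e (endPoint (P f))
  ends-sink = proj₁ (proj₂ (proj₂ (proj₂ nest)))

  sink-end : ∀ pt → IsSink h d e pt → ∃ λ f → endPoint (P f) ≡ pt
  sink-end = proj₁ (proj₂ (proj₂ (proj₂ (proj₂ nest))))

  nested : ∀ k l → k Fin.< l → NestedBelow (P k) (P l)
  nested = proj₁ (proj₂ (proj₂ (proj₂ (proj₂ (proj₂ (proj₂ nest))))))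

  below-d : ∀ f (i : ℕ) y → (+ i , y) ∈ nonSinkPoints (P f) → y ℤ.≤ d i
  below-d = proj₂ (proj₂ (proj₂ (proj₂ (proj₂ (proj₂ (proj₂ nest))))))

  s t : Fin r → ℕ
  s f = proj₁ (starts-source f)
  t f = proj₁ (ends-sink f)

  s≤h : ∀ f → s f ℕ.≤ h
  s≤h f = proj₁ (proj₂ (starts-source f))

  t≤h : ∀ f → t f ℕ.≤ h
  t≤h f = proj₁ (proj₂ (ends-sink f))

  x₀≡s : ∀ f → Run.x₀ f ≡ + s f
  x₀≡s f = proj₁ (proj₂ (proj₂ (starts-source f)))

  xEnd≡t : ∀ f → proj₁ (endPoint (P f)) ≡ + t f
  xEnd≡t f = proj₁ (proj₂ (proj₂ (ends-sink f)))

  yEnd : Fin r → ℤ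
  yEnd f = proj₂ (endPoint (P f))

  σ τ : Fin r → ℤ
  σ f = Run.y₀ f - u (s f)
  τ f = yEnd f - u (t f)

  σ-range : ∀ f → g (s f) ℤ.< σ f × σ f ℤ.≤ g (suc (s f))
  σ-range f = let _ , _ , _ , e<y , y≤d = starts-source f in source⇒rank (s f) (Run.y₀ f) e<y y≤d

  τ-range : ∀ f → g (suc (t f)) ℤ.< τ f × τ f ℤ.≤ g (t f)
  τ-range f = let _ , _ , _ , d<y , y≤e = ends-sink f in sink⇒rank (t f) (yEnd f) d<y y≤e

  t≡s+width : ∀ f → t f ≡ s f ℕ.+ Run.width f
  t≡s+width f = ℤP.+-injective (begin
    + t f                        ≡⟨ xEnd≡t f ⟨
    proj₁ (endPoint (P f))       ≡⟨ cong proj₁ (Run.endPoint≡ f) ⟩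
    Run.x₀ f + + Run.width f         ≡⟨ cong (_+ + Run.width f) (x₀≡s f) ⟩
    + (s f ℕ.+ Run.width f)        ∎)
    where open ≡-Reasoning

  s<t : ∀ f → s f ℕ.< t f
  s<t f = subst (s f ℕ.<_) (sym (t≡s+width f))
    (subst (ℕ._≤ s f ℕ.+ Run.width f) (ℕP.+-comm (s f) 1) (ℕP.+-monoʳ-≤ (s f) (Run.width-pos f)))

  s<h : ∀ f → s f ℕ.< h
  s<h f = ℕP.<-≤-trans (s<t f) (t≤h f)

  topAt : Fin r → ℕ → ℤ
  topAt f c = Run.top f (c ∸ s f)

  topAt-start : ∀ f → topAt f (s f) ≡ Run.y₀ f
  topAt-start f = trans (cong (Run.top f) (ℕP.n∸n≡0 (s f))) (height-0 (Run.y₀ f) (runsOf (P f)))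

  topAt-end : ∀ f → topAt f (t f) ≡ yEnd f
  topAt-end f = trans (cong (Run.top f) (trans (cong (_∸ s f) (t≡s+width f)) (ℕP.m+n∸m≡n (s f) (Run.width f))))
                      (sym (cong proj₂ (Run.endPoint≡ f)))

  topAt-suc≤ : ∀ f c → s f ℕ.≤ c → topAt f (suc c) ℤ.≤ topAt f c
  topAt-suc≤ f c s≤c = subst (λ j → Run.top f j ℤ.≤ topAt f c) (sym (ℕP.+-∸-assoc 1 s≤c))
    (height-suc≤ (Run.y₀ f) (runsOf (P f)) (c ∸ s f))

  column-offset : ∀ f c → s f ℕ.≤ c → Run.x₀ f + + (c ∸ s f) ≡ + c
  column-offset f c s≤c = trans (cong (_+ + (c ∸ s f)) (x₀≡s f)) (cong +_ (ℕP.m+[n∸m]≡n s≤c))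

  column-in-width : ∀ f c → s f ℕ.≤ c → c ℕ.< t f → c ∸ s f ℕ.< Run.width f
  column-in-width f c s≤c c<t = subst (c ∸ s f ℕ.<_) (ℕP.m+n∸m≡n (s f) (Run.width f))
    (ℕP.∸-monoˡ-< (subst (c ℕ.<_) (t≡s+width f) c<t) s≤c)

  yInterval-at : ∀ f c → s f ℕ.≤ c → c ℕ.≤ t f → YInterval (P f) (+ c) (topAt f (suc c)) (topAt f c)
  yInterval-at f c s≤c c≤t = subst₂ (λ x lo → YInterval (P f) x lo (topAt f c))
    (column-offset f c s≤c) (cong (Run.top f) (sym (ℕP.+-∸-assoc 1 s≤c)))
    (Run.yInterval f (c ∸ s f) (subst (c ∸ s f ℕ.≤_) (ℕP.m+n∸m≡n (s f) (Run.width f))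
      (ℕP.∸-monoˡ-≤ (s f) (subst (c ℕ.≤_) (t≡s+width f) c≤t))))

  ∈nonSink-at⇔ : ∀ f c y → s f ℕ.≤ c → c ℕ.< t f →
    ((+ c , y) ∈ nonSinkPoints (P f)) ⇔ (topAt f (suc c) ℤ.≤ y × y ℤ.≤ topAt f c)
  ∈nonSink-at⇔ f c y s≤c c<t = to , from
    where
    at-suc : topAt f (suc c) ≡ Run.top f (suc (c ∸ s f))
    at-suc = cong (Run.top f) (ℕP.+-∸-assoc 1 s≤c)
    to : (+ c , y) ∈ nonSinkPoints (P f) → topAt f (suc c) ℤ.≤ y × y ℤ.≤ topAt f c
    to m with proj₁ (Run.∈nonSink⇔ f _) m
    ... | j , _ , eq , lo , hi with +-cancelˡ-ℕ (Run.x₀ f) (trans (column-offset f c s≤c) eq)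
    ... | refl = subst (ℤ._≤ y) (sym at-suc) lo , hi
    from : topAt f (suc c) ℤ.≤ y × y ℤ.≤ topAt f c → (+ c , y) ∈ nonSinkPoints (P f)
    from (lo , hi) = proj₂ (Run.∈nonSink⇔ f _)
      (c ∸ s f , column-in-width f c s≤c c<t , sym (column-offset f c s≤c) , subst (ℤ._≤ y) at-suc lo , hi)

  nonSink-column : ∀ f x y → (x , y) ∈ nonSinkPoints (P f) → ∃ λ c → x ≡ + c × s f ℕ.≤ c × c ℕ.< t f
  nonSink-column f x y m with proj₁ (Run.∈nonSink⇔ f _) m
  ... | j , j<w , eq , _ = s f ℕ.+ j , trans eq (cong (_+ + j) (x₀≡s f)) , ℕP.m≤m+n (s f) j ,
    subst (s f ℕ.+ j ℕ.<_) (sym (t≡s+width f)) (ℕP.+-monoʳ-< (s f) j<w)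

  nested-s≤ : ∀ k l → toℕ k ℕ.< toℕ l → s k ℕ.≤ s l
  nested-s≤ k l k<l = ℤ.drop‿+≤+ (subst₂ ℤ._≤_ (x₀≡s k) (x₀≡s l) (proj₁ (proj₁ (nested k l k<l))))

  nested-t≥ : ∀ k l → toℕ k ℕ.< toℕ l → t l ℕ.≤ t k
  nested-t≥ k l k<l = ℤ.drop‿+≤+ (subst₂ ℤ._≤_ (xEnd≡t l) (xEnd≡t k) (proj₂ (proj₁ (nested k l k<l))))

  nested-topAt< : ∀ k l → toℕ k ℕ.< toℕ l → ∀ c → s l ℕ.≤ c → c ℕ.≤ t l → topAt k c ℤ.< topAt l c
  nested-topAt< k l k<l c s≤c c≤t = proj₂ (proj₂ (nested k l k<l) (+ c)
    (subst (ℤ._≤ + c) (sym (x₀≡s l)) (ℤ.+≤+ s≤c)) (subst (+ c ℤ.≤_) (sym (xEnd≡t l)) (ℤ.+≤+ c≤t)) _ _ _ _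
    (yInterval-at k c (ℕP.≤-trans (nested-s≤ k l k<l) s≤c) (ℕP.≤-trans c≤t (nested-t≥ k l k<l)))
    (yInterval-at l c s≤c c≤t))

  private
    -<- : ∀ {a b c} → a ℤ.< b → a - c ℤ.< b - c
    -<- {a} {b} {c} a<b = <-byDiff (ring a b c) (<⇒diff a<b)
      where
      ring : ∀ a b c → b - c - (1ℤ + (a - c)) ≡ b - (1ℤ + a)
      ring = solve-∀

  σ-increasing : ∀ k l → toℕ k ℕ.< toℕ l → σ k ℤ.< σ l
  σ-increasing k l k<l with s k ℕP.≟ s l
  ... | yes s≡ = subst (λ c → σ k ℤ.< Run.y₀ l - u c) s≡ (-<- (subst₂ ℤ._<_
      (trans (cong (topAt k) (sym s≡)) (topAt-start k)) (topAt-start l)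
      (nested-topAt< k l k<l (s l) ℕP.≤-refl (ℕP.<⇒≤ (s<t l)))))
  ... | no s≢ = ℤP.≤-<-trans (proj₂ (σ-range k)) (ℤP.≤-<-trans rising (proj₁ (σ-range l)))
    where
    rising : g (suc (s k)) ℤ.≤ g (s l)
    rising = g-rising-before (suc (s k)) (s l) (s l) (ℕP.≤∧≢⇒< (nested-s≤ k l k<l) s≢) ℕP.≤-refl (s≤h l)
      (g-rises⇒δ-pos (s l) (ℤP.<-≤-trans (proj₁ (σ-range l)) (proj₂ (σ-range l))))

  τ-increasing : ∀ k l → toℕ k ℕ.< toℕ l → τ k ℤ.< τ l
  τ-increasing k l k<l with t l ℕP.≟ t k
  ... | yes t≡ = subst (λ c → yEnd k - u c ℤ.< τ l) t≡ (-<- (subst₂ ℤ._<_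
      (trans (cong (topAt k) t≡) (topAt-end k)) (topAt-end l)
      (nested-topAt< k l k<l (t l) (ℕP.<⇒≤ (s<t l)) ℕP.≤-refl)))
  ... | no t≢ = ℤP.≤-<-trans (proj₂ (τ-range k)) (ℤP.≤-<-trans falling (proj₁ (τ-range l)))
    where
    falling : g (t k) ℤ.≤ g (suc (t l))
    falling = g-falling-after (t l) (suc (t l)) (t k) (ℕP.n≤1+n _) (ℕP.≤∧≢⇒< (nested-t≥ k l k<l) t≢)
      (ℕP.m≤n⇒m≤1+n (t≤h k)) (g-falls⇒δ-neg (t l) (ℤP.<-≤-trans (proj₁ (τ-range l)) (proj₂ (τ-range l))))

  σ-positive : ∀ f → 1ℤ ℤ.≤ σ f
  σ-positive f = ℤP.i<j⇒suc[i]≤j (ℤP.≤-<-trans (g-nonneg (s f) (ℕP.m≤n⇒m≤1+n (s≤h f))) (proj₁ (σ-range f)))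

  τ-positive : ∀ f → 1ℤ ℤ.≤ τ f
  τ-positive f = ℤP.i<j⇒suc[i]≤j (ℤP.≤-<-trans (g-nonneg (suc (t f)) (s≤s (t≤h f))) (proj₁ (τ-range f)))

  source-of-rank : ∀ c v → c ℕ.≤ h → g c ℤ.< v → v ℤ.≤ g (suc c) → ∃ λ f → σ f ≡ v × s f ≡ c
  source-of-rank c v c≤h g<v v≤g with source-start (+ c , u c + v) (c , c≤h , refl , rank⇒source c v g<v v≤g)
  ... | f , start≡ = f , trans (cong₂ _-_ (cong proj₂ start≡) (cong u s≡c)) (u+v-u≡v c v) , s≡c
    where
    s≡c : s f ≡ c
    s≡c = ℤP.+-injective (trans (sym (x₀≡s f)) (cong proj₁ start≡))

  sink-of-rank : ∀ c v → c ℕ.≤ h → g (suc c) ℤ.< v → v ℤ.≤ g c → ∃ λ f → τ f ≡ v × t f ≡ c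
  sink-of-rank c v c≤h g<v v≤g with sink-end (+ c , u c + v) (c , c≤h , refl , rank⇒sink c v g<v v≤g)
  ... | f , end≡ = f , trans (cong₂ _-_ (cong proj₂ end≡) (cong u t≡c)) (u+v-u≡v c v) , t≡c
    where
    t≡c : t f ≡ c
    t≡c = ℤP.+-injective (trans (sym (xEnd≡t f)) (cong proj₁ end≡))

  σ-downClosed : ∀ f v → 1ℤ ℤ.≤ v → v ℤ.≤ σ f → ∃ λ f′ → σ f′ ≡ v
  σ-downClosed f v 1≤v v≤σ with g (s f) ℤP.<? v
  ... | yes g<v = let f′ , σ≡ , _ = source-of-rank (s f) v (s≤h f) g<v (ℤP.≤-trans v≤σ (proj₂ (σ-range f))) in f′ , σ≡
  ... | no g≮v with crossing-up v (s f) (ℤP.suc[i]≤j⇒i<j 1≤v) (ℤP.≮⇒≥ g≮v)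
  ...   | a , a<s , g<v , v≤g = let f′ , σ≡ , _ = source-of-rank a v (ℕP.≤-trans (ℕP.<⇒≤ a<s) (s≤h f)) g<v v≤g in f′ , σ≡

  τ-downClosed : ∀ f v → 1ℤ ℤ.≤ v → v ℤ.≤ τ f → ∃ λ f′ → τ f′ ≡ v
  τ-downClosed f v 1≤v v≤τ with g (suc (t f)) ℤP.<? v
  ... | yes g<v = let f′ , τ≡ , _ = sink-of-rank (t f) v (t≤h f) g<v (ℤP.≤-trans v≤τ (proj₂ (τ-range f))) in f′ , τ≡
  ... | no g≮v with crossing-down v (suc (t f)) (ℤP.suc[i]≤j⇒i<j 1≤v) (s≤s (t≤h f)) (ℤP.≮⇒≥ g≮v)
  ...   | b , _ , b≤h , g<v , v≤g = let f′ , τ≡ , _ = sink-of-rank b v b≤h g<v v≤g in f′ , τ≡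

  I : Fin r → ℤ
  I f = + suc (toℕ f)

  σ≡I : ∀ f → σ f ≡ I f
  σ≡I = consecutive-ranks σ σ-increasing σ-positive σ-downClosed

  τ≡I : ∀ f → τ f ≡ I f
  τ≡I = consecutive-ranks τ τ-increasing τ-positive τ-downClosed

  source-range : ∀ f → g (s f) ℤ.< I f × I f ℤ.≤ g (suc (s f))
  source-range f = subst (λ v → g (s f) ℤ.< v × v ℤ.≤ g (suc (s f))) (σ≡I f) (σ-range f)

  sink-range : ∀ f → g (suc (t f)) ℤ.< I f × I f ℤ.≤ g (t f)
  sink-range f = subst (λ v → g (suc (t f)) ℤ.< v × v ℤ.≤ g (t f)) (τ≡I f) (τ-range f)

  y₀≡ : ∀ f → Run.y₀ f ≡ u (s f) + I f
  y₀≡ f = trans (y≡u+[y-u] (s f) (Run.y₀ f)) (cong (λ w → u (s f) + w) (σ≡I f))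

  yEnd≡ : ∀ f → yEnd f ≡ u (t f) + I f
  yEnd≡ f = trans (y≡u+[y-u] (t f) (yEnd f)) (cong (λ w → u (t f) + w) (τ≡I f))

  occupies⇔ : ∀ f c → c ℕ.< h → (s f ℕ.≤ c × c ℕ.< t f) ⇔ (I f ℤ.≤ g (suc c))
  occupies⇔ f = column-range⇔ (I f) (s f) (t f) (s≤h f) (t≤h f)
    (proj₁ (source-range f)) (proj₂ (source-range f)) (proj₁ (sink-range f)) (proj₂ (sink-range f))

  has-nonSink⇔ : ∀ f c → (∃ λ y → (+ c , y) ∈ nonSinkPoints (P f)) ⇔ (s f ℕ.≤ c × c ℕ.< t f)
  has-nonSink⇔ f c = to , from
    where
    to : (∃ λ y → (+ c , y) ∈ nonSinkPoints (P f)) → s f ℕ.≤ c × c ℕ.< t f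
    to (y , m) with nonSink-column f (+ c) y m
    ... | c′ , x≡ , s≤c′ , c′<t with ℤP.+-injective x≡
    ... | refl = s≤c′ , c′<t
    from : s f ℕ.≤ c × c ℕ.< t f → ∃ λ y → (+ c , y) ∈ nonSinkPoints (P f)
    from (s≤c , c<t) = topAt f c , proj₂ (∈nonSink-at⇔ f c _ s≤c c<t) (topAt-suc≤ f c s≤c , ℤP.≤-refl)

  nonSinkColumns : NonSinkColumns h d e πs
  nonSinkColumns c c<h f = (λ has → proj₁ (occupies⇔ f c c<h) (proj₁ (has-nonSink⇔ f c) has)) ,
                           (λ I≤g → proj₂ (has-nonSink⇔ f c) (proj₂ (occupies⇔ f c c<h) I≤g))

  index-exists : ∀ n c → c ℕ.≤ h → + suc n ℤ.≤ g (suc c) → ∃ λ (f : Fin r) → toℕ f ≡ n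
  index-exists n c c≤h n<g = f , ℕP.suc-injective (ℤP.+-injective (trans (sym (σ≡I f)) σf≡))
    where
    crossing : ∃ λ a → a ℕ.< suc c × g a ℤ.< + suc n × + suc n ℤ.≤ g (suc a)
    crossing = crossing-up (+ suc n) (suc c) (ℤ.+<+ (s≤s z≤n)) n<g
    a : ℕ
    a = proj₁ crossing
    source : ∃ λ f → σ f ≡ + suc n × s f ≡ a
    source = source-of-rank a (+ suc n) (ℕP.≤-trans (ℕP.≤-pred (proj₁ (proj₂ crossing))) c≤h)
      (proj₁ (proj₂ (proj₂ crossing))) (proj₂ (proj₂ (proj₂ crossing)))
    f : Fin r
    f = proj₁ source
    σf≡ : σ f ≡ + suc n
    σf≡ = proj₁ (proj₂ source)

  occupies : ∀ f c → c ℕ.< h → I f ℤ.≤ g (suc c) → s f ℕ.≤ c × c ℕ.< t f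
  occupies f c c<h = proj₂ (occupies⇔ f c c<h)

  next-index : ∀ f c → c ℕ.≤ h → 1ℤ + I f ℤ.≤ g (suc c) → ∃ λ f′ → toℕ f′ ≡ suc (toℕ f)
  next-index f c = index-exists (suc (toℕ f)) c

  topAt-last : ∀ f c → c ℕ.< h → I f ℤ.≤ g (suc c) → g (suc (suc c)) ℤ.< I f →
               topAt f (suc c) ≡ u (suc c) + I f
  topAt-last f c c<h I≤g g<I =
    trans (cong (topAt f) (sym t≡)) (trans (topAt-end f) (trans (yEnd≡ f) (cong (λ c → u c + I f) t≡)))
    where
    t≡ : t f ≡ suc c
    t≡ = descent-unique (I f) (t f) (suc c) (t≤h f) c<h (proj₁ (sink-range f)) (proj₂ (sink-range f)) g<I I≤g

  source-column : ∀ f c → c ℕ.< h → I f ℤ.≤ g (suc c) → g c ℤ.< I f → s f ≡ c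
  source-column f c c<h I≤g g<I =
    ascent-unique (I f) (s f) c (s≤h f) (ℕP.<⇒≤ c<h) (proj₁ (source-range f)) (proj₂ (source-range f)) g<I I≤g

  topAt-first : ∀ f c → c ℕ.< h → I f ℤ.≤ g (suc c) → g c ℤ.< I f → topAt f c ≡ u c + I f
  topAt-first f c c<h I≤g g<I =
    trans (cong (topAt f) (sym s≡)) (trans (topAt-start f) (trans (y₀≡ f) (cong (λ c → u c + I f) s≡)))
    where
    s≡ : s f ≡ c
    s≡ = source-column f c c<h I≤g g<I

  private
    <-suc⇒≤ : ∀ {a x i} → a ℤ.< x + (1ℤ + i) → a ℤ.≤ x + i
    <-suc⇒≤ {a} {x} {i} lt = ≤-byDiff (ring a x i) (<⇒diff lt)
      where
      ring : ∀ a x i → x + i - a ≡ x + (1ℤ + i) - (1ℤ + a)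
      ring = solve-∀

    index< : ∀ {f f′ : Fin r} → toℕ f′ ≡ suc (toℕ f) → toℕ f ℕ.< toℕ f′
    index< f′≡ = ℕP.≤-reflexive (sym f′≡)

  -- Base of a downward induction on I f: the last path through column c either ends at
  -- column c+1, or the next path starts right above it there, or it is capped by d.
  topAt≤u+I-last : ∀ f c → c ℕ.< h → I f ≡ g (suc c) → topAt f (suc c) ℤ.≤ u (suc c) + I f
  topAt≤u+I-last f c c<h I≡g with g (suc (suc c)) ℤP.<? I f
  ... | yes g<I = ℤP.≤-reflexive (topAt-last f c c<h (ℤP.≤-reflexive I≡g) g<I)
  ... | no g≮I with suc c ℕP.<? h
  ...   | no c+1≮h = ⊥-elim (g≮I (subst (ℤ._< I f)
            (sym (trans (cong (λ c → g (suc c)) (ℕP.≤-antisym c<h (ℕP.≮⇒≥ c+1≮h))) g-end)) (ℤ.+<+ (s≤s z≤n))))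
  ...   | yes c+1<h with 1ℤ + I f ℤP.≤? g (suc (suc c))
  ...     | no next≰ = ℤP.≤-trans (below-d f (suc c) _ top∈)
              (ℤP.≤-trans (ℤP.≤-reflexive (d≡u+g (suc c))) (ℤP.+-monoʳ-≤ (u (suc c)) (<1+⇒≤ (ℤP.≰⇒> next≰))))
      where
      occ : s f ℕ.≤ suc c × suc c ℕ.< t f
      occ = occupies f (suc c) c+1<h (ℤP.≮⇒≥ g≮I)
      top∈ : (+ suc c , topAt f (suc c)) ∈ nonSinkPoints (P f)
      top∈ = proj₂ (∈nonSink-at⇔ f (suc c) _ (proj₁ occ) (proj₂ occ)) (topAt-suc≤ f (suc c) (proj₁ occ) , ℤP.≤-refl)
  ...     | yes next≤ = <-suc⇒≤ {x = u (suc c)} (ℤP.<-≤-trans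
              (nested-topAt< f f′ (index< f′≡) (suc c) (proj₁ occ′) (ℕP.<⇒≤ (proj₂ occ′)))
              (ℤP.≤-reflexive (trans (topAt-first f′ (suc c) c+1<h I′≤ g<I′) (cong (λ w → u (suc c) + w) I′≡))))
      where
      f′ : Fin r
      f′ = proj₁ (next-index f (suc c) (ℕP.<⇒≤ c+1<h) next≤)
      f′≡ : toℕ f′ ≡ suc (toℕ f)
      f′≡ = proj₂ (next-index f (suc c) (ℕP.<⇒≤ c+1<h) next≤)
      I′≡ : I f′ ≡ 1ℤ + I f
      I′≡ = cong (λ n → + suc n) f′≡
      I′≤ : I f′ ℤ.≤ g (suc (suc c))
      I′≤ = subst (ℤ._≤ g (suc (suc c))) (sym I′≡) next≤
      g<I′ : g (suc c) ℤ.< I f′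
      g<I′ = subst₂ ℤ._<_ I≡g (sym I′≡) (ℤ.+<+ ℕP.≤-refl)
      occ′ : s f′ ℕ.≤ suc c × suc c ℕ.< t f′
      occ′ = occupies f′ (suc c) c+1<h I′≤

  topAt≤u+I : ∀ f c → c ℕ.< h → I f ℤ.≤ g (suc c) → topAt f (suc c) ℤ.≤ u (suc c) + I f
  topAt≤u+I f c c<h I≤g =
    go ℤ.∣ g (suc c) - I f ∣ f (trans (ring (g (suc c)) (I f)) (cong (λ w → I f + w) (sym (ℤP.0≤i⇒+∣i∣≡i (≤⇒diff I≤g)))))
    where
    ring : ∀ g i → g ≡ i + (g - i)
    ring = solve-∀
    go : ∀ gap f → g (suc c) ≡ I f + + gap → topAt f (suc c) ℤ.≤ u (suc c) + I f
    go zero      f g≡ = topAt≤u+I-last f c c<h (sym (trans g≡ (ℤP.+-identityʳ (I f))))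
    go (suc gap) f g≡ = <-suc⇒≤ {x = u (suc c)} (ℤP.<-≤-trans
        (nested-topAt< f f′ (index< f′≡) (suc c) (ℕP.m≤n⇒m≤1+n (proj₁ occ′)) (proj₂ occ′))
        (subst (λ w → topAt f′ (suc c) ℤ.≤ u (suc c) + w) I′≡ (go gap f′ g≡′)))
      where
      shift-one : ∀ i x → i + (1ℤ + x) ≡ 1ℤ + i + x
      shift-one = solve-∀
      g≡1+I+gap : g (suc c) ≡ 1ℤ + I f + + gap
      g≡1+I+gap = trans g≡ (shift-one (I f) (+ gap))
      next≤ : 1ℤ + I f ℤ.≤ g (suc c)
      next≤ = subst (1ℤ + I f ℤ.≤_) (sym g≡1+I+gap) (x≤x+n (1ℤ + I f) gap)
      next : ∃ λ f′ → toℕ f′ ≡ suc (toℕ f)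
      next = next-index f c (ℕP.<⇒≤ c<h) next≤
      f′ : Fin r
      f′ = proj₁ next
      f′≡ : toℕ f′ ≡ suc (toℕ f)
      f′≡ = proj₂ next
      I′≡ : I f′ ≡ 1ℤ + I f
      I′≡ = cong (λ n → + suc n) f′≡
      g≡′ : g (suc c) ≡ I f′ + + gap
      g≡′ = trans g≡1+I+gap (cong (_+ + gap) (sym I′≡))
      occ′ : s f′ ℕ.≤ c × c ℕ.< t f′
      occ′ = occupies f′ c c<h (subst (ℤ._≤ g (suc c)) (sym I′≡) next≤)

  -- slide k i is the i-th part of λ_(k): how far the entry of π_i into column k lies below u k + i.
  slide : ℕ → ℕ → ℕ
  slide k zero = 0
  slide k (suc n) with n ℕP.<? r | + suc n ℤP.≤? g k
  ... | yes n<r | yes _ = ℤ.∣ u k + + suc n - topAt (Fin.fromℕ< n<r) k ∣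
  ... | _       | _     = 0

  slide-beyond : ∀ k n → g k ℤ.< + suc n → slide k (suc n) ≡ 0
  slide-beyond k n g<n with n ℕP.<? r | + suc n ℤP.≤? g k
  ... | yes _ | yes n≤g = ⊥-elim (ℤP.<⇒≱ g<n n≤g)
  ... | yes _ | no _    = refl
  ... | no _  | _       = refl

  slide-value : ∀ f c → c ℕ.< h → I f ℤ.≤ g (suc c) → + slide (suc c) (suc (toℕ f)) ≡ u (suc c) + I f - topAt f (suc c)
  slide-value f c c<h I≤g with toℕ f ℕP.<? r | I f ℤP.≤? g (suc c)
  ... | yes f<r | yes _ = trans (cong (λ f′ → + ℤ.∣ u (suc c) + I f - topAt f′ (suc c) ∣) (FinP.fromℕ<-toℕ f f<r))
                                (ℤP.0≤i⇒+∣i∣≡i (≤⇒diff (topAt≤u+I f c c<h I≤g)))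
  ... | no f≮r  | _     = ⊥-elim (f≮r (FinP.toℕ<n f))
  ... | yes _   | no I≰ = ⊥-elim (I≰ I≤g)

  slide-of-index : ∀ f n c → toℕ f ≡ n → c ℕ.< h → I f ℤ.≤ g (suc c) →
                   + slide (suc c) (suc n) ≡ u (suc c) + + suc n - topAt f (suc c)
  slide-of-index f _ c refl = slide-value f c

  slide-antitone : ∀ c → c ℕ.< h → Antitone₁ (slide (suc c))
  slide-antitone c c<h j = [ present , absent ]′ (toSum (+ suc (suc j) ℤP.≤? g (suc c)))
    where
    absent : ¬ (+ suc (suc j) ℤ.≤ g (suc c)) → slide (suc c) (suc (suc j)) ℕ.≤ slide (suc c) (suc j)
    absent j+2≰ = subst (ℕ._≤ slide (suc c) (suc j)) (sym (slide-beyond (suc c) (suc j) (ℤP.≰⇒> j+2≰))) z≤n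
    present : + suc (suc j) ℤ.≤ g (suc c) → slide (suc c) (suc (suc j)) ℕ.≤ slide (suc c) (suc j)
    present j+2≤ = ℤ.drop‿+≤+ (subst₂ ℤ._≤_ (sym (slide-of-index f′ (suc j) c f′≡ c<h I′≤)) (sym (slide-of-index f j c f≡ c<h I≤))
      (≤-byDiff (ring (u (suc c)) (+ suc j) (topAt f (suc c)) (topAt f′ (suc c)))
        (<⇒diff (nested-topAt< f f′ f<f′ (suc c) (ℕP.m≤n⇒m≤1+n (proj₁ occ′)) (proj₂ occ′)))))
      where
      j+1≤ : + suc j ℤ.≤ g (suc c)
      j+1≤ = ℤP.≤-trans (ℤ.+≤+ (ℕP.n≤1+n _)) j+2≤
      f : Fin r
      f = proj₁ (index-exists j c (ℕP.<⇒≤ c<h) j+1≤)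
      f′ : Fin r
      f′ = proj₁ (index-exists (suc j) c (ℕP.<⇒≤ c<h) j+2≤)
      f≡ : toℕ f ≡ j
      f≡ = proj₂ (index-exists j c (ℕP.<⇒≤ c<h) j+1≤)
      f′≡ : toℕ f′ ≡ suc j
      f′≡ = proj₂ (index-exists (suc j) c (ℕP.<⇒≤ c<h) j+2≤)
      f<f′ : toℕ f ℕ.< toℕ f′
      f<f′ = ℕP.≤-reflexive (trans (cong suc f≡) (sym f′≡))
      I≤ : I f ℤ.≤ g (suc c)
      I≤ = subst (λ n → + suc n ℤ.≤ g (suc c)) (sym f≡) j+1≤
      I′≤ : I f′ ℤ.≤ g (suc c)
      I′≤ = subst (λ n → + suc n ℤ.≤ g (suc c)) (sym f′≡) j+2≤
      occ′ : s f′ ℕ.≤ c × c ℕ.< t f′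
      occ′ = occupies f′ c c<h I′≤
      ring : ∀ u i t t′ → u + i - t - (u + (1ℤ + i) - t′) ≡ t′ - (1ℤ + t)
      ring = solve-∀
  
  lamOf : ℕ → List ℕ
  lamOf k = positivePrefix (slide k) ℤ.∣ g k ∣

  ∣g∣≡g : ∀ k → k ℕ.≤ suc h → + ℤ.∣ g k ∣ ≡ g k
  ∣g∣≡g k k≤h+1 = ℤP.0≤i⇒+∣i∣≡i (g-nonneg k k≤h+1)

  entry-lamOf : ∀ c → c ℕ.< h → ∀ n → entry (lamOf (suc c)) (suc n) ≡ slide (suc c) (suc n)
  entry-lamOf c c<h = entry-positivePrefix (slide (suc c)) ℤ.∣ g (suc c) ∣ (slide-antitone c c<h) vanishes
    where
    vanishes : ∀ j → ℤ.∣ g (suc c) ∣ ℕ.< j → slide (suc c) j ≡ 0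
    vanishes (suc n) lt = slide-beyond (suc c) n (subst (ℤ._< + suc n) (∣g∣≡g (suc c) (s≤s (ℕP.<⇒≤ c<h))) (ℤ.+<+ lt))

  -- π_i with i > g_(k+1) ends on x = k, at height u k + i, so its part of λ_(k) vanishes.
  slide-ending : ∀ c → c ℕ.< h → ∀ n → g (suc (suc c)) ℤ.< + suc n → slide (suc c) (suc n) ≡ 0
  slide-ending c c<h n g<n = [ present , slide-beyond (suc c) n ∘ ℤP.≰⇒> ]′ (toSum (+ suc n ℤP.≤? g (suc c)))
    where
    present : + suc n ℤ.≤ g (suc c) → slide (suc c) (suc n) ≡ 0
    present n≤g = ℤP.+-injective (trans (slide-of-index f n c f≡ c<h I≤) (trans
        (cong (λ w → u (suc c) + + suc n - w) (topAt-last f c c<h I≤ (subst (λ m → g (suc (suc c)) ℤ.< + suc m) (sym f≡) g<n)))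
        (trans (cong (λ i → u (suc c) + + suc n - (u (suc c) + i)) (cong (λ m → + suc m) f≡)) (ℤP.+-inverseʳ (u (suc c) + + suc n)))))
      where
      f : Fin r
      f = proj₁ (index-exists n c (ℕP.<⇒≤ c<h) n≤g)
      f≡ : toℕ f ≡ n
      f≡ = proj₂ (index-exists n c (ℕP.<⇒≤ c<h) n≤g)
      I≤ : I f ℤ.≤ g (suc c)
      I≤ = subst (λ m → + suc m ℤ.≤ g (suc c)) (sym f≡) n≤g

  lamFamily : LamFamily h d e lamOf
  lamFamily (suc c) (s≤s z≤n) k≤h-1 =
    (positivePrefix-linked (slide k) ℤ.∣ g k ∣ (slide-antitone c c<h) , positivePrefix-positive (slide k) ℤ.∣ g k ∣) ,
    subst (+ length (lamOf k) ℤ.≤_) (∣g∣≡g k (ℕP.m≤n⇒m≤1+n (ℕP.<⇒≤ k<h))) (ℤ.+≤+ (length-positivePrefix≤ (slide k) ℤ.∣ g k ∣)) ,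
    subst (+ length (lamOf k) ℤ.≤_) (∣g∣≡g (suc k) (s≤s (ℕP.<⇒≤ k<h)))
      (ℤ.+≤+ (length-positivePrefix≤zero (slide k) ℤ.∣ g k ∣ ℤ.∣ g (suc k) ∣
        (slide-ending c c<h ℤ.∣ g (suc k) ∣ (subst (ℤ._< + suc ℤ.∣ g (suc k) ∣) (∣g∣≡g (suc k) (s≤s (ℕP.<⇒≤ k<h))) (ℤ.+<+ ℕP.≤-refl)))))
    where
    k : ℕ
    k = suc c
    k<h : k ℕ.< h
    k<h = m≤n∸1⇒m<n 1≤h k≤h-1
    c<h : c ℕ.< h
    c<h = ℕP.<-trans (ℕP.n<1+n c) k<h

  private
    a-[a-t]≡t : ∀ a t → a - (a - t) ≡ t
    a-[a-t]≡t = solve-∀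

  Ilo≡topAt : ∀ f c → c ℕ.< h → I f ℤ.≤ g (suc c) → Ilo h d e lamOf c (suc (toℕ f)) ≡ topAt f (suc c)
  Ilo≡topAt f c c<h I≤g with suc c ℕP.<? h
  ... | yes c+1<h = begin
    u (suc c) + I f - + entry (lamExt h lamOf (suc c)) (suc (toℕ f))
      ≡⟨ cong (λ L → u (suc c) + I f - + entry L (suc (toℕ f))) (lamExt-inner h lamOf c c+1<h) ⟩
    u (suc c) + I f - + entry (lamOf (suc c)) (suc (toℕ f))
      ≡⟨ cong (λ n → u (suc c) + I f - + n) (entry-lamOf c c<h (toℕ f)) ⟩
    u (suc c) + I f - + slide (suc c) (suc (toℕ f))
      ≡⟨ cong (λ w → u (suc c) + I f - w) (slide-value f c c<h I≤g) ⟩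
    u (suc c) + I f - (u (suc c) + I f - topAt f (suc c))
      ≡⟨ a-[a-t]≡t (u (suc c) + I f) (topAt f (suc c)) ⟩
    topAt f (suc c) ∎
    where open ≡-Reasoning
  ... | no c+1≮h = begin
    u (suc c) + I f - + entry (lamExt h lamOf (suc c)) (suc (toℕ f))
      ≡⟨ cong (λ L → u (suc c) + I f - + entry L (suc (toℕ f))) (lamExt-outer h lamOf c (ℕP.≮⇒≥ c+1≮h)) ⟩
    u (suc c) + I f - + 0
      ≡⟨ x-0≡x (u (suc c) + I f) ⟩
    u (suc c) + I f
      ≡⟨ topAt-last f c c<h I≤g g<I ⟨
    topAt f (suc c) ∎
    where
    open ≡-Reasoning
    g<I : g (suc (suc c)) ℤ.< I f
    g<I = subst (ℤ._< I f) (sym (trans (cong (λ c → g (suc c)) (ℕP.≤-antisym c<h (ℕP.≮⇒≥ c+1≮h))) g-end)) (ℤ.+<+ (s≤s z≤n))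

  Ihi≡topAt : ∀ f c → c ℕ.< h → I f ℤ.≤ g (suc c) → Ihi h d e lamOf c (suc (toℕ f)) ≡ topAt f c
  Ihi≡topAt f zero c<h I≤g = trans (x-0≡x (u 0 + I f)) (sym (topAt-first f 0 c<h I≤g (ℤ.+<+ (s≤s z≤n))))
  Ihi≡topAt f (suc c) c+1<h I≤g = begin
    u (suc c) + I f - + entry (lamExt h lamOf (suc c)) (suc (toℕ f))
      ≡⟨ cong (λ L → u (suc c) + I f - + entry L (suc (toℕ f))) (lamExt-inner h lamOf c c+1<h) ⟩
    u (suc c) + I f - + entry (lamOf (suc c)) (suc (toℕ f))
      ≡⟨ cong (λ n → u (suc c) + I f - + n) (entry-lamOf c c<h (toℕ f)) ⟩
    u (suc c) + I f - + slide (suc c) (suc (toℕ f))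
      ≡⟨ [ through , starting ]′ (toSum (I f ℤP.≤? g (suc c))) ⟩
    topAt f (suc c) ∎
    where
    open ≡-Reasoning
    c<h : c ℕ.< h
    c<h = ℕP.<-trans (ℕP.n<1+n c) c+1<h
    through : I f ℤ.≤ g (suc c) → u (suc c) + I f - + slide (suc c) (suc (toℕ f)) ≡ topAt f (suc c)
    through I≤g′ = trans (cong (λ w → u (suc c) + I f - w) (slide-value f c c<h I≤g′))
                         (a-[a-t]≡t (u (suc c) + I f) (topAt f (suc c)))
    starting : ¬ (I f ℤ.≤ g (suc c)) → u (suc c) + I f - + slide (suc c) (suc (toℕ f)) ≡ topAt f (suc c)
    starting I≰g = trans (cong (λ n → u (suc c) + I f - + n) (slide-beyond (suc c) (toℕ f) (ℤP.≰⇒> I≰g)))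
      (trans (x-0≡x (u (suc c) + I f)) (sym (topAt-first f (suc c) c+1<h I≤g (ℤP.≰⇒> I≰g))))

  hasIntervals : HasIntervals h d e lamOf πs
  hasIntervals = index≤r , intervals
    where
    index≤r : ∀ c i → suc c ℕ.≤ h → 1 ℕ.≤ i → + i ℤ.≤ g (suc c) → i ℕ.≤ r
    index≤r c (suc n) c<h _ n<g = let f , f≡ = index-exists n c (ℕP.<⇒≤ c<h) n<g in
      subst (λ m → suc m ℕ.≤ r) f≡ (FinP.toℕ<n f)
    intervals : ∀ c f → suc c ℕ.≤ h → I f ℤ.≤ g (suc c) → ∀ y →
      ((+ c , y) ∈ nonSinkPoints (P f)) ⇔ (Ilo h d e lamOf c (suc (toℕ f)) ℤ.≤ y × y ℤ.≤ Ihi h d e lamOf c (suc (toℕ f)))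
    intervals c f c<h I≤g y = subst₂ (λ lo hi → ((+ c , y) ∈ nonSinkPoints (P f)) ⇔ (lo ℤ.≤ y × y ℤ.≤ hi))
      (sym (Ilo≡topAt f c c<h I≤g)) (sym (Ihi≡topAt f c c<h I≤g))
      (∈nonSink-at⇔ f c y (proj₁ (occupies f c c<h I≤g)) (proj₂ (occupies f c c<h I≤g)))

  lamOf-unique : (lam′ : ℕ → List ℕ) → LamFamily h d e lam′ → HasIntervals h d e lam′ πs →
                 ∀ k → 1 ℕ.≤ k → k ℕ.≤ h ∸ 1 → lam′ k ≡ lamOf k
  lamOf-unique lam′ family′ intervals′ (suc c) 1≤k k≤h-1 =
    ≡-by-entry (lam′ k) (lamOf k) (proj₂ (proj₁ (family′ k 1≤k k≤h-1)))
      (positivePrefix-positive (slide k) ℤ.∣ g k ∣) same-entry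
    where
    k : ℕ
    k = suc c
    k<h : k ℕ.< h
    k<h = m≤n∸1⇒m<n 1≤h k≤h-1
    c<h : c ℕ.< h
    c<h = ℕP.<-trans (ℕP.n<1+n c) k<h
    outside : ∀ n → ¬ (+ suc n ℤ.≤ g k) → entry (lam′ k) (suc n) ≡ entry (lamOf k) (suc n)
    outside n n≰g = trans
      (entry-beyond (lam′ k) (suc n) (ℤP.drop‿+<+ (ℤP.≤-<-trans (proj₁ (proj₂ (family′ k 1≤k k≤h-1))) (ℤP.≰⇒> n≰g))))
      (sym (trans (entry-lamOf c c<h n) (slide-beyond k n (ℤP.≰⇒> n≰g))))
    -- Both families describe the same lower end topAt f k of the interval of π_(n+1) on x = c.
    inside : ∀ n → + suc n ℤ.≤ g k → entry (lam′ k) (suc n) ≡ entry (lamOf k) (suc n)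
    inside n n≤g = subst (λ m → entry (lam′ k) (suc m) ≡ entry (lamOf k) (suc m)) f≡ (begin
      entry (lam′ k) (suc (toℕ f))              ≡⟨ cong (λ L → entry L (suc (toℕ f))) (lamExt-inner h lam′ c k<h) ⟨
      entry (lamExt h lam′ k) (suc (toℕ f))     ≡⟨ x-m≡x-n⇒m≡n (u k + I f) (trans (sym lower′) (sym (Ilo≡topAt f c c<h I≤g))) ⟩
      entry (lamExt h lamOf k) (suc (toℕ f))    ≡⟨ cong (λ L → entry L (suc (toℕ f))) (lamExt-inner h lamOf c k<h) ⟩
      entry (lamOf k) (suc (toℕ f))             ∎)
      where
      open ≡-Reasoning
      f : Fin r
      f = proj₁ (index-exists n c (ℕP.<⇒≤ c<h) n≤g)
      f≡ : toℕ f ≡ n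
      f≡ = proj₂ (index-exists n c (ℕP.<⇒≤ c<h) n≤g)
      I≤g : I f ℤ.≤ g k
      I≤g = subst (λ m → + suc m ℤ.≤ g k) (sym f≡) n≤g
      occ : s f ℕ.≤ c × c ℕ.< t f
      occ = occupies f c c<h I≤g
      lower′ : topAt f k ≡ Ilo h d e lam′ c (suc (toℕ f))
      lower′ = interval-lower-unique (topAt-suc≤ f c (proj₁ occ)) λ y →
        (λ y∈ → proj₁ (proj₂ intervals′ c f c<h I≤g y) (proj₂ (∈nonSink-at⇔ f c y (proj₁ occ) (proj₂ occ)) y∈)) ,
        (λ y∈ → proj₁ (∈nonSink-at⇔ f c y (proj₁ occ) (proj₂ occ)) (proj₂ (proj₂ intervals′ c f c<h I≤g y) y∈))
    same-entry : ∀ n → entry (lam′ k) (suc n) ≡ entry (lamOf k) (suc n)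
    same-entry n = [ inside n , outside n ]′ (toSum (+ suc n ℤP.≤? g k))

  ∈nonSink⇔OnIntervals : ∀ lam → HasIntervals h d e lam πs →
                         ∀ f q → (q ∈ nonSinkPoints (P f)) ⇔ OnIntervals lam (suc (toℕ f)) q
  ∈nonSink⇔OnIntervals lam intervals f (x , y) = to , from
    where
    to : (x , y) ∈ nonSinkPoints (P f) → OnIntervals lam (suc (toℕ f)) (x , y)
    to m with nonSink-column f x y m
    ... | c , refl , s≤c , c<t = c , refl , c<h , I≤g , proj₁ (proj₂ intervals c f c<h I≤g y) m
      where
      c<h : c ℕ.< h
      c<h = ℕP.<-≤-trans c<t (t≤h f)
      I≤g : I f ℤ.≤ g (suc c)
      I≤g = proj₁ (occupies⇔ f c c<h) (s≤c , c<t)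
    from : OnIntervals lam (suc (toℕ f)) (x , y) → (x , y) ∈ nonSinkPoints (P f)
    from (c , refl , c<h , I≤g , y∈) = proj₂ (proj₂ intervals c f c<h I≤g y) y∈

  part-i : NonSinkColumns h d e πs
    × Σ (ℕ → List ℕ) (λ lam → LamFamily h d e lam × HasIntervals h d e lam πs
      × ((lam′ : ℕ → List ℕ) → LamFamily h d e lam′ → HasIntervals h d e lam′ πs →
          ∀ k → 1 ℕ.≤ k → k ℕ.≤ h ∸ 1 → lam′ k ≡ lam k))
  part-i = nonSinkColumns , lamOf , lamFamily , hasIntervals , lamOf-unique

-- Part (ii): the nest with prescribed intervals

module Construction (h : ℕ) (p : IrrationalCut) (d e : ℕ → ℤ) (den : IsDen h p d e)
  (lam : ℕ → List ℕ) (family : LamFamily h d e lam) (ineq : IntervalIneq h d e lam) where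

  open Den h p d e den

  -- Ilo h d e lam c is definitionally Hi (suc c).
  Hi : ℕ → ℕ → ℤ
  Hi = Ihi h d e lam

  lamExt-shape : ∀ c → c ℕ.≤ h → Linked ℕ._≥_ (lamExt h lam c) ×
    + length (lamExt h lam c) ℤ.≤ g c × + length (lamExt h lam c) ℤ.≤ g (suc c)
  lamExt-shape zero    _       = [] , ℤP.≤-refl , g-nonneg 1 (s≤s z≤n)
  lamExt-shape (suc c) c+1≤h = [ inner , outer ]′ (toSum (suc c ℕP.<? h))
    where
    Shape : List ℕ → Set
    Shape L = Linked ℕ._≥_ L × + length L ℤ.≤ g (suc c) × + length L ℤ.≤ g (suc (suc c))
    inner : suc c ℕ.< h → Shape (lamExt h lam (suc c))
    inner c+1<h = subst Shape (sym (lamExt-inner h lam c c+1<h))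
      (let part , short₁ , short₂ = family (suc c) (s≤s z≤n) (m<n⇒m≤n∸1 c+1<h) in proj₁ part , short₁ , short₂)
    outer : ¬ (suc c ℕ.< h) → Shape (lamExt h lam (suc c))
    outer c+1≮h = subst Shape (sym (lamExt-outer h lam c (ℕP.≮⇒≥ c+1≮h)))
      ([] , g-nonneg (suc c) (s≤s (ℕP.<⇒≤ c+1≤h)) , g-nonneg (suc (suc c)) (s≤s c+1≤h))

  Hi-increasing : ∀ c i i′ → c ℕ.≤ h → 1 ℕ.≤ i → i ℕ.< i′ → Hi c i ℤ.< Hi c i′
  Hi-increasing c (suc i) (suc i′) c≤h _ (s≤s i<i′) = <-byDiff (ring (u c) (+ suc i) (+ suc i′) (+ entry L (suc i)) (+ entry L (suc i′)))
    (+-nonneg (<⇒diff (ℤ.+<+ (s≤s i<i′))) (≤⇒diff (ℤ.+≤+ (entry-antitone L (proj₁ (lamExt-shape c c≤h)) (ℕP.<⇒≤ i<i′)))))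
    where
    L : List ℕ
    L = lamExt h lam c
    ring : ∀ a i i′ x x′ → a + i′ - x′ - (1ℤ + (a + i - x)) ≡ i′ - (1ℤ + i) + (x - x′)
    ring = solve-∀

  Hi-unslid : ∀ c i → entry (lamExt h lam c) i ≡ 0 → Hi c i ≡ u c + + i
  Hi-unslid c i entry≡0 = trans (cong (λ n → u c + + i - + n) entry≡0) (x-0≡x (u c + + i))

  Hi-before : ∀ c i → c ℕ.≤ h → g c ℤ.< + i → Hi c i ≡ u c + + i
  Hi-before c i c≤h g<i = Hi-unslid c i (entry-beyond _ i (ℤP.drop‿+<+ (ℤP.≤-<-trans (proj₁ (proj₂ (lamExt-shape c c≤h))) g<i)))

  Hi-after : ∀ c i → c ℕ.≤ h → g (suc c) ℤ.< + i → Hi c i ≡ u c + + i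
  Hi-after c i c≤h g<i = Hi-unslid c i (entry-beyond _ i (ℤP.drop‿+<+ (ℤP.≤-<-trans (proj₂ (proj₂ (lamExt-shape c c≤h))) g<i)))

  Hi-descends : ∀ c i → c ℕ.< h → 1 ℕ.≤ i → + i ℤ.≤ g (suc c) → Hi (suc c) i ℤ.≤ Hi c i
  Hi-descends c i c<h 1≤i i≤g = ≤-byDiff (ring (u c) (u (suc c)) (+ entry (lamExt h lam c) i) (+ entry (lamExt h lam (suc c)) i) (+ i))
    (≤⇒diff (ineq c i c<h 1≤i i≤g))
    where
    ring : ∀ a b x y i → a + i - x - (b + i - y) ≡ a - x - (b - y)
    ring = solve-∀

  Hi≤d : ∀ c i → + i ℤ.≤ g (suc c) → Hi c i ℤ.≤ d c
  Hi≤d c i i≤g = ℤP.≤-trans (≤-byDiff (ring (u c) (+ i) (+ entry (lamExt h lam c) i)) (ℕ-nonneg _))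
    (subst (u c + + i ℤ.≤_) (sym (d≡u+g c)) (ℤP.+-monoʳ-≤ (u c) i≤g))
    where
    ring : ∀ a i x → a + i - (a + i - x) ≡ x
    ring = solve-∀

  maxG : ℕ → ℕ
  maxG zero    = 0
  maxG (suc c) = maxG c ℕ.⊔ ℤ.∣ g (suc c) ∣

  R : ℕ
  R = maxG h

  ∣g∣≡g : ∀ c → c ℕ.< h → + ℤ.∣ g (suc c) ∣ ≡ g (suc c)
  ∣g∣≡g c c<h = ℤP.0≤i⇒+∣i∣≡i (g-nonneg (suc c) (s≤s (ℕP.<⇒≤ c<h)))

  ≤maxG : ∀ n c i → c ℕ.< n → i ℕ.≤ ℤ.∣ g (suc c) ∣ → i ℕ.≤ maxG n
  ≤maxG (suc n) c i c<n+1 i≤ with c ℕP.≟ n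
  ... | yes refl = ℕP.≤-trans i≤ (ℕP.m≤n⊔m (maxG n) _)
  ... | no c≢n   = ℕP.≤-trans (≤maxG n c i (ℕP.≤∧≢⇒< (ℕP.≤-pred c<n+1) c≢n) i≤) (ℕP.m≤m⊔n _ _)

  ≤R : ∀ c i → c ℕ.< h → + i ℤ.≤ g (suc c) → i ℕ.≤ R
  ≤R c i c<h i≤g = ≤maxG h c i c<h (ℤ.drop‿+≤+ (subst (+ i ℤ.≤_) (sym (∣g∣≡g c c<h)) i≤g))

  maxG-attained : ∀ n i → n ℕ.≤ h → 1 ℕ.≤ i → i ℕ.≤ maxG n → ∃ λ c → c ℕ.< n × + i ℤ.≤ g (suc c)
  maxG-attained zero    i _   1≤i i≤0 = ⊥-elim (ℕP.<⇒≱ 1≤i i≤0)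
  maxG-attained (suc n) i n<h 1≤i i≤ with i ℕP.≤? maxG n
  ... | yes i≤max = let c , c<n , i≤g = maxG-attained n i (ℕP.<⇒≤ n<h) 1≤i i≤max in c , ℕP.m≤n⇒m≤1+n c<n , i≤g
  ... | no i≰max with ℕP.≤-total (maxG n) ℤ.∣ g (suc n) ∣
  ...   | inj₂ g≤max = ⊥-elim (i≰max (subst (i ℕ.≤_) (ℕP.m≥n⇒m⊔n≡m g≤max) i≤))
  ...   | inj₁ max≤g = n , ℕP.≤-refl ,
          subst (+ i ℤ.≤_) (∣g∣≡g n n<h) (ℤ.+≤+ (subst (i ℕ.≤_) (ℕP.m≤n⇒m⊔n≡n max≤g) i≤))

  module Path (f : Fin R) where

    i : ℕ
    i = suc (toℕ f)

    -- π_i runs from the column where g first reaches i to the column where it falls below i.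
    opaque
      private
        witness : ∃ λ c → c ℕ.< h × + i ℤ.≤ g (suc c)
        witness = maxG-attained h i ℕP.≤-refl (s≤s z≤n) (FinP.toℕ<n f)

        ascent : ∃ λ a → a ℕ.< suc (proj₁ witness) × g a ℤ.< + i × + i ℤ.≤ g (suc a)
        ascent = crossing-up (+ i) (suc (proj₁ witness)) (ℤ.+<+ (s≤s z≤n)) (proj₂ (proj₂ witness))

      s : ℕ
      s = proj₁ ascent

      s<h : s ℕ.< h
      s<h = ℕP.<-≤-trans (proj₁ (proj₂ ascent)) (proj₁ (proj₂ witness))

      g<i : g s ℤ.< + i
      g<i = proj₁ (proj₂ (proj₂ ascent))

      i≤g : + i ℤ.≤ g (suc s)
      i≤g = proj₂ (proj₂ (proj₂ ascent))

      private
        descent : ∃ λ b → suc s ℕ.≤ b × b ℕ.≤ h × g (suc b) ℤ.< + i × + i ℤ.≤ g b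
        descent = crossing-down (+ i) (suc s) (ℤ.+<+ (s≤s z≤n)) (s≤s (ℕP.<⇒≤ s<h)) i≤g

      t : ℕ
      t = proj₁ descent

      s<t : s ℕ.< t
      s<t = proj₁ (proj₂ descent)

      t≤h : t ℕ.≤ h
      t≤h = proj₁ (proj₂ (proj₂ descent))

      g′<i : g (suc t) ℤ.< + i
      g′<i = proj₁ (proj₂ (proj₂ (proj₂ descent)))

      i≤g′ : + i ℤ.≤ g t
      i≤g′ = proj₂ (proj₂ (proj₂ (proj₂ descent)))

    occupies⇔ : ∀ c → c ℕ.< h → (s ℕ.≤ c × c ℕ.< t) ⇔ (+ i ℤ.≤ g (suc c))
    occupies⇔ = column-range⇔ (+ i) s t (ℕP.<⇒≤ s<h) t≤h g<i i≤g g′<i i≤g′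

    width : ℕ
    width = t ∸ s

    s+width≡t : s ℕ.+ width ≡ t
    s+width≡t = ℕP.m+[n∸m]≡n (ℕP.<⇒≤ s<t)

    H : ℕ → ℤ
    H j = Hi (s ℕ.+ j) i

    H-descends : ∀ j → j ℕ.< width → H (suc j) ℤ.≤ H j
    H-descends j j<w = subst (λ c → Hi c i ℤ.≤ H j) (sym (ℕP.+-suc s j))
      (Hi-descends (s ℕ.+ j) i (ℕP.<-≤-trans s+j<t t≤h) (s≤s z≤n)
        (proj₁ (occupies⇔ (s ℕ.+ j) (ℕP.<-≤-trans s+j<t t≤h)) (ℕP.m≤m+n s j , s+j<t)))
      where
      s+j<t : s ℕ.+ j ℕ.< t
      s+j<t = subst (s ℕ.+ j ℕ.<_) s+width≡t (ℕP.+-monoʳ-< s j<w)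

    drops : List ℕ
    drops = dropsOf H width

    π : EEPath
    π = (+ s , H 0) , bodyOf drops

    π-runs : steps π ≡ runs drops
    π-runs = bodyOf-∷ʳ drops (subst (1 ℕ.≤_) (sym (length-dropsOf H width)) (ℕP.m<n⇒0<n∸m s<t))

    module Run = RunForm π drops π-runs

    top≡H : ∀ j → j ℕ.≤ width → Run.top j ≡ H j
    top≡H = height-dropsOf H width H-descends

    start≡ : start π ≡ (+ s , u s + + i)
    start≡ = cong (+ s ,_) (trans (cong (λ c → Hi c i) (ℕP.+-identityʳ s)) (Hi-before s i (ℕP.<⇒≤ s<h) g<i))

    end≡ : endPoint π ≡ (+ t , u t + + i)
    end≡ = trans Run.endPoint≡ (cong₂ _,_ (cong +_ (trans (cong (s ℕ.+_) (length-dropsOf H width)) s+width≡t))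
      (trans (cong Run.top (length-dropsOf H width)) (trans (top≡H width ℕP.≤-refl)
        (trans (cong (λ c → Hi c i) s+width≡t) (Hi-after t i t≤h g′<i)))))

    source : IsSource h d e (start π)
    source = subst (IsSource h d e) (sym start≡) (s , ℕP.<⇒≤ s<h , refl , rank⇒source s (+ i) g<i i≤g)

    sink : IsSink h d e (endPoint π)
    sink = subst (IsSink h d e) (sym end≡) (t , t≤h , refl , rank⇒sink t (+ i) g′<i i≤g′)

    width≡ : length drops ≡ width
    width≡ = length-dropsOf H width

    offset : ∀ c → s ℕ.≤ c → s ℕ.+ (c ∸ s) ≡ c
    offset c s≤c = ℕP.m+[n∸m]≡n s≤c

    ∈nonSink⇔OnIntervals : ∀ q → (q ∈ nonSinkPoints π) ⇔ OnIntervals lam i q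
    ∈nonSink⇔OnIntervals (x , y) = to , from
      where
      to : (x , y) ∈ nonSinkPoints π → OnIntervals lam i (x , y)
      to m with proj₁ (Run.∈nonSink⇔ (x , y)) m
      ... | j , j<len , refl , lo , hi = s ℕ.+ j , refl , ℕP.<-≤-trans s+j<t t≤h ,
            proj₁ (occupies⇔ (s ℕ.+ j) (ℕP.<-≤-trans s+j<t t≤h)) (ℕP.m≤m+n s j , s+j<t) ,
            subst (ℤ._≤ y) (trans (top≡H (suc j) j<w) (cong (λ c → Hi c i) (ℕP.+-suc s j))) lo ,
            subst (y ℤ.≤_) (top≡H j (ℕP.<⇒≤ j<w)) hi
        where
        j<w : j ℕ.< width
        j<w = subst (j ℕ.<_) width≡ j<len
        s+j<t : s ℕ.+ j ℕ.< t
        s+j<t = subst (s ℕ.+ j ℕ.<_) s+width≡t (ℕP.+-monoʳ-< s j<w)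
      from : OnIntervals lam i (x , y) → (x , y) ∈ nonSinkPoints π
      from (c , refl , c<h , i≤g , lo , hi) = proj₂ (Run.∈nonSink⇔ (+ c , y))
        (j , subst (j ℕ.<_) (sym width≡) j<w , cong +_ (sym (offset c s≤c)) ,
         subst (ℤ._≤ y) (sym (trans (top≡H (suc j) j<w) (cong (λ c → Hi c i) (trans (ℕP.+-suc s j) (cong suc (offset c s≤c)))))) lo ,
         subst (y ℤ.≤_) (sym (trans (top≡H j (ℕP.<⇒≤ j<w)) (cong (λ c → Hi c i) (offset c s≤c)))) hi)
        where
        occ : s ℕ.≤ c × c ℕ.< t
        occ = proj₂ (occupies⇔ c c<h) i≤g
        s≤c : s ℕ.≤ c
        s≤c = proj₁ occ
        j : ℕ
        j = c ∸ s
        j<w : j ℕ.< width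
        j<w = ℕP.∸-monoˡ-< (proj₂ occ) s≤c

    bottom : ℕ → ℤ
    bottom c = Run.top (suc (c ∸ s))

    yInterval-at : ∀ c → s ℕ.≤ c → c ℕ.≤ t → YInterval π (+ c) (bottom c) (Hi c i)
    yInterval-at c s≤c c≤t = subst₂ (λ x hi → YInterval π x (bottom c) hi)
      (cong +_ (offset c s≤c)) (trans (top≡H (c ∸ s) j≤w) (cong (λ c → Hi c i) (offset c s≤c)))
      (Run.yInterval (c ∸ s) (subst (c ∸ s ℕ.≤_) (sym width≡) j≤w))
      where
      j≤w : c ∸ s ℕ.≤ width
      j≤w = ℕP.∸-monoˡ-≤ s c≤t

    bottom-inside : ∀ c → s ℕ.≤ c → c ℕ.< t → bottom c ≡ Hi (suc c) i
    bottom-inside c s≤c c<t = trans (top≡H (suc (c ∸ s)) (ℕP.∸-monoˡ-< c<t s≤c))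
      (cong (λ c → Hi c i) (trans (ℕP.+-suc s (c ∸ s)) (cong suc (offset c s≤c))))

    bottom-last : bottom t ≡ Hi t i
    bottom-last = begin
      Run.top (suc width)        ≡⟨ height-beyond Run.y₀ drops width (ℕP.≤-reflexive width≡) ⟩
      Run.top width              ≡⟨ top≡H width ℕP.≤-refl ⟩
      Hi (s ℕ.+ width) i        ≡⟨ cong (λ c → Hi c i) s+width≡t ⟩
      Hi t i                    ∎
      where open ≡-Reasoning

    bottom≤ : ∀ c → s ℕ.≤ c → c ℕ.≤ t → bottom c ℤ.≤ Hi c i
    bottom≤ c s≤c c≤t = subst (bottom c ℤ.≤_) (trans (top≡H (c ∸ s) (ℕP.∸-monoˡ-≤ s c≤t)) (cong (λ c → Hi c i) (offset c s≤c)))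
      (height-suc≤ _ drops (c ∸ s))

  πs : List EEPath
  πs = tabulate Path.π

  index : Fin (length πs) → Fin R
  index = Fin.cast (LP.length-tabulate Path.π)

  lookup-πs : ∀ k → lookup πs k ≡ Path.π (index k)
  lookup-πs k = subst (λ k′ → lookup πs k′ ≡ Path.π (index k))
    (FinP.cast-involutive (sym (LP.length-tabulate Path.π)) (LP.length-tabulate Path.π) k)
    (LP.lookup-tabulate Path.π (index k))

  position : ∀ n → n ℕ.< R → ∃ λ k → toℕ (index k) ≡ n
  position n n<R = Fin.cast (sym (LP.length-tabulate Path.π)) f ,
    trans (cong toℕ (FinP.cast-involutive (LP.length-tabulate Path.π) (sym (LP.length-tabulate Path.π)) f))
      (FinP.toℕ-fromℕ< n<R)
    where
    f : Fin R
    f = Fin.fromℕ< n<R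

  positive-rank : ∀ {a v} → 0ℤ ℤ.≤ a → a ℤ.< v → ∃ λ n → v ≡ + suc n
  positive-rank 0≤a a<v = 0<⇒≡+suc (ℤP.≤-<-trans 0≤a a<v)

  column<h : ∀ c n → c ℕ.≤ h → + suc n ℤ.≤ g (suc c) → c ℕ.< h
  column<h c n c≤h i≤g with c ℕP.≟ h
  ... | no c≢h   = ℕP.≤∧≢⇒< c≤h c≢h
  ... | yes refl = ⊥-elim (ℤP.<⇒≱ (subst (ℤ._< + suc n) (sym g-end) (ℤ.+<+ (s≤s z≤n))) i≤g)

  start-of-source : ∀ pt → IsSource h d e pt → ∃ λ k → start (lookup πs k) ≡ pt
  start-of-source (x , y) (c , c≤h , refl , e<y , y≤d) = k , (begin
    start (lookup πs k)                       ≡⟨ cong start (lookup-πs k) ⟩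
    start (Path.π (index k))                  ≡⟨ Path.start≡ (index k) ⟩
    (+ Path.s (index k) , u (Path.s (index k)) + I)
                                              ≡⟨ cong (λ c → + c , u c + I) s≡c ⟩
    (+ c , u c + I)                           ≡⟨ cong (+ c ,_) (trans (cong (λ w → u c + w) (trans I≡ (sym v≡))) (sym (y≡u+[y-u] c y))) ⟩
    (+ c , y)                                 ∎)
    where
    open ≡-Reasoning
    rank : g c ℤ.< y - u c × y - u c ℤ.≤ g (suc c)
    rank = source⇒rank c y e<y y≤d
    n : ℕ
    n = proj₁ (positive-rank (g-nonneg c (ℕP.m≤n⇒m≤1+n c≤h)) (proj₁ rank))
    v≡ : y - u c ≡ + suc n
    v≡ = proj₂ (positive-rank (g-nonneg c (ℕP.m≤n⇒m≤1+n c≤h)) (proj₁ rank))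
    i≤g : + suc n ℤ.≤ g (suc c)
    i≤g = subst (ℤ._≤ g (suc c)) v≡ (proj₂ rank)
    c<h : c ℕ.< h
    c<h = column<h c n c≤h i≤g
    k : Fin (length πs)
    k = proj₁ (position n (≤R c (suc n) c<h i≤g))
    k≡ : toℕ (index k) ≡ n
    k≡ = proj₂ (position n (≤R c (suc n) c<h i≤g))
    I : ℤ
    I = + suc (toℕ (index k))
    I≡ : I ≡ + suc n
    I≡ = cong (λ m → + suc m) k≡
    s≡c : Path.s (index k) ≡ c
    s≡c = ascent-unique I (Path.s (index k)) c (ℕP.<⇒≤ (Path.s<h (index k))) c≤h
      (Path.g<i (index k)) (Path.i≤g (index k))
      (subst (g c ℤ.<_) (sym I≡) (subst (g c ℤ.<_) v≡ (proj₁ rank))) (subst (ℤ._≤ g (suc c)) (sym I≡) i≤g)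

  toℕ-index : ∀ k → toℕ (index k) ≡ toℕ k
  toℕ-index = FinP.toℕ-cast (LP.length-tabulate Path.π)

  end-of-sink : ∀ pt → IsSink h d e pt → ∃ λ k → endPoint (lookup πs k) ≡ pt
  end-of-sink (x , y) (zero , _ , refl , d<y , y≤e) =
    ⊥-elim (ℤP.<⇒≱ (ℤP.≤-<-trans (g-nonneg 1 (s≤s z≤n)) (proj₁ (sink⇒rank 0 y d<y y≤e))) (proj₂ (sink⇒rank 0 y d<y y≤e)))
  end-of-sink (x , y) (suc c , c+1≤h , refl , d<y , y≤e) = k , (begin
    endPoint (lookup πs k)                    ≡⟨ cong endPoint (lookup-πs k) ⟩
    endPoint (Path.π (index k))               ≡⟨ Path.end≡ (index k) ⟩
    (+ Path.t (index k) , u (Path.t (index k)) + I)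
                                              ≡⟨ cong (λ c → + c , u c + I) t≡c ⟩
    (+ suc c , u (suc c) + I)                 ≡⟨ cong (+ suc c ,_) (trans (cong (λ w → u (suc c) + w) (trans I≡ (sym v≡))) (sym (y≡u+[y-u] (suc c) y))) ⟩
    (+ suc c , y)                             ∎)
    where
    open ≡-Reasoning
    rank : g (suc (suc c)) ℤ.< y - u (suc c) × y - u (suc c) ℤ.≤ g (suc c)
    rank = sink⇒rank (suc c) y d<y y≤e
    n : ℕ
    n = proj₁ (positive-rank (g-nonneg (suc (suc c)) (s≤s c+1≤h)) (proj₁ rank))
    v≡ : y - u (suc c) ≡ + suc n
    v≡ = proj₂ (positive-rank (g-nonneg (suc (suc c)) (s≤s c+1≤h)) (proj₁ rank))
    i≤g : + suc n ℤ.≤ g (suc c)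
    i≤g = subst (ℤ._≤ g (suc c)) v≡ (proj₂ rank)
    k : Fin (length πs)
    k = proj₁ (position n (≤R c (suc n) c+1≤h i≤g))
    k≡ : toℕ (index k) ≡ n
    k≡ = proj₂ (position n (≤R c (suc n) c+1≤h i≤g))
    I : ℤ
    I = + suc (toℕ (index k))
    I≡ : I ≡ + suc n
    I≡ = cong (λ m → + suc m) k≡
    t≡c : Path.t (index k) ≡ suc c
    t≡c = descent-unique I (Path.t (index k)) (suc c) (Path.t≤h (index k)) c+1≤h
      (Path.g′<i (index k)) (Path.i≤g′ (index k))
      (subst (g (suc (suc c)) ℤ.<_) (sym I≡) (subst (g (suc (suc c)) ℤ.<_) v≡ (proj₁ rank))) (subst (ℤ._≤ g (suc c)) (sym I≡) i≤g)

  private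
    ranked-point-injective : ∀ (col : Fin R → ℕ) k l →
      (+ col (index k) , u (col (index k)) + + suc (toℕ (index k))) ≡ (+ col (index l) , u (col (index l)) + + suc (toℕ (index l))) →
      k ≡ l
    ranked-point-injective col k l eq = FinP.toℕ-injective (begin
      toℕ k            ≡⟨ toℕ-index k ⟨
      toℕ (index k)    ≡⟨ ℕP.suc-injective (+-cancelˡ-ℕ (u (col (index k))) (trans (,-injectiveʳ eq) (cong (λ c → u c + + suc (toℕ (index l))) (sym col≡)))) ⟩
      toℕ (index l)    ≡⟨ toℕ-index l ⟩
      toℕ l            ∎)
      where
      open ≡-Reasoning
      col≡ : col (index k) ≡ col (index l)
      col≡ = ℤP.+-injective (,-injectiveˡ eq)

  starts-injective : ∀ k l → start (lookup πs k) ≡ start (lookup πs l) → k ≡ l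
  starts-injective k l eq = ranked-point-injective Path.s k l (begin
    _                            ≡⟨ Path.start≡ (index k) ⟨
    start (Path.π (index k))     ≡⟨ cong start (lookup-πs k) ⟨
    start (lookup πs k)          ≡⟨ eq ⟩
    start (lookup πs l)          ≡⟨ cong start (lookup-πs l) ⟩
    start (Path.π (index l))     ≡⟨ Path.start≡ (index l) ⟩
    _                            ∎)
    where open ≡-Reasoning

  ends-injective : ∀ k l → endPoint (lookup πs k) ≡ endPoint (lookup πs l) → k ≡ l
  ends-injective k l eq = ranked-point-injective Path.t k l (begin
    _                              ≡⟨ Path.end≡ (index k) ⟨
    endPoint (Path.π (index k))    ≡⟨ cong endPoint (lookup-πs k) ⟨
    endPoint (lookup πs k)         ≡⟨ eq ⟩
    endPoint (lookup πs l)         ≡⟨ cong endPoint (lookup-πs l) ⟩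
    endPoint (Path.π (index l))    ≡⟨ Path.end≡ (index l) ⟩
    _                              ∎)
    where open ≡-Reasoning

  module _ (f f′ : Fin R) (f<f′ : toℕ f ℕ.< toℕ f′) where

    private
      module A = Path f
      module B = Path f′

      i<i′ : A.i ℕ.< B.i
      i<i′ = s≤s f<f′

      below-occupies : ∀ c → c ℕ.< h → + B.i ℤ.≤ g (suc c) → A.s ℕ.≤ c × c ℕ.< A.t
      below-occupies c c<h i′≤g = proj₂ (A.occupies⇔ c c<h) (ℤP.≤-trans (ℤ.+≤+ (ℕP.<⇒≤ i<i′)) i′≤g)

    nested-starts : A.s ℕ.≤ B.s
    nested-starts = proj₁ (below-occupies B.s B.s<h B.i≤g)

    nested-ends : B.t ℕ.≤ A.t
    nested-ends with B.t | B.s<t | B.t≤h | B.i≤g′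
    ... | suc c | _ | c<h | i′≤g = proj₂ (below-occupies c c<h i′≤g)

    nested-columns : ∀ c → B.s ℕ.≤ c → c ℕ.≤ B.t → A.bottom c ℤ.< B.bottom c × Hi c A.i ℤ.< Hi c B.i
    nested-columns c sB≤c c≤tB = bottoms< , tops<
      where
      sA≤c : A.s ℕ.≤ c
      sA≤c = ℕP.≤-trans nested-starts sB≤c
      c≤tA : c ℕ.≤ A.t
      c≤tA = ℕP.≤-trans c≤tB nested-ends
      tops< : Hi c A.i ℤ.< Hi c B.i
      tops< = Hi-increasing c A.i B.i (ℕP.≤-trans c≤tA A.t≤h) (s≤s z≤n) i<i′
      bottoms< : A.bottom c ℤ.< B.bottom c
      bottoms< with c ℕP.<? B.t
      ... | yes c<t′ = subst₂ ℤ._<_ (sym (A.bottom-inside c sA≤c (ℕP.<-≤-trans c<t′ nested-ends))) (sym (B.bottom-inside c sB≤c c<t′))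
                         (Hi-increasing (suc c) A.i B.i (ℕP.≤-trans c<t′ B.t≤h) (s≤s z≤n) i<i′)
      ... | no c≮t′ = ℤP.≤-<-trans (A.bottom≤ c sA≤c c≤tA) (subst (Hi c A.i ℤ.<_) (sym B-bottom) tops<)
        where
        c≡t′ : c ≡ B.t
        c≡t′ = ℕP.≤-antisym c≤tB (ℕP.≮⇒≥ c≮t′)
        B-bottom : B.bottom c ≡ Hi c B.i
        B-bottom = trans (cong B.bottom c≡t′) (trans B.bottom-last (cong (λ c → Hi c B.i) (sym c≡t′)))

    paths-nested : NestedBelow A.π B.π
    paths-nested =
      (ℤ.+≤+ nested-starts , subst₂ ℤ._≤_ (sym (cong proj₁ B.end≡)) (sym (cong proj₁ A.end≡)) (ℤ.+≤+ nested-ends)) , columns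
      where
      columns : ∀ x → + B.s ℤ.≤ x → x ℤ.≤ proj₁ (endPoint B.π) → ∀ v w v′ w′ →
                YInterval A.π x v w → YInterval B.π x v′ w′ → v ℤ.< v′ × w ℤ.< w′
      columns -[1+ n ] s′≤x _ _ _ _ _ _ _ = ⊥-elim (ℤP.<⇒≱ ℤ.-<+ s′≤x)
      columns (+ c) s′≤c c≤t′ v w v′ w′ Y Y′ =
        subst₂ ℤ._<_ (sym (proj₁ A-int)) (sym (proj₁ B-int)) (proj₁ (nested-columns c sB≤c c≤tB)) ,
        subst₂ ℤ._<_ (sym (proj₂ A-int)) (sym (proj₂ B-int)) (proj₂ (nested-columns c sB≤c c≤tB))
        where
        sB≤c : B.s ℕ.≤ c
        sB≤c = ℤ.drop‿+≤+ s′≤c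
        c≤tB : c ℕ.≤ B.t
        c≤tB = ℤ.drop‿+≤+ (subst (+ c ℤ.≤_) (cong proj₁ B.end≡) c≤t′)
        A-int : v ≡ A.bottom c × w ≡ Hi c A.i
        A-int = yInterval-unique (A.bottom≤ c (ℕP.≤-trans nested-starts sB≤c) (ℕP.≤-trans c≤tB nested-ends))
                  (A.yInterval-at c (ℕP.≤-trans nested-starts sB≤c) (ℕP.≤-trans c≤tB nested-ends)) Y
        B-int : v′ ≡ B.bottom c × w′ ≡ Hi c B.i
        B-int = yInterval-unique (B.bottom≤ c sB≤c c≤tB) (B.yInterval-at c sB≤c c≤tB) Y′

  ∈nonSink⇔OnIntervals : ∀ k q → (q ∈ nonSinkPoints (lookup πs k)) ⇔ OnIntervals lam (suc (toℕ k)) q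
  ∈nonSink⇔OnIntervals k q = subst₂ _⇔_
    (cong (λ π → q ∈ nonSinkPoints π) (sym (lookup-πs k)))
    (cong (λ n → OnIntervals lam (suc n) q) (toℕ-index k))
    (Path.∈nonSink⇔OnIntervals (index k) q)

  πs-nest : IsNest h d e πs
  πs-nest = starts-source , start-of-source , starts-injective , ends-sink , end-of-sink , ends-injective , nested , below-d
    where
    starts-source : ∀ k → IsSource h d e (start (lookup πs k))
    starts-source k = subst (λ π → IsSource h d e (start π)) (sym (lookup-πs k)) (Path.source (index k))
    ends-sink : ∀ k → IsSink h d e (endPoint (lookup πs k))
    ends-sink k = subst (λ π → IsSink h d e (endPoint π)) (sym (lookup-πs k)) (Path.sink (index k))
    nested : ∀ k l → k Fin.< l → NestedBelow (lookup πs k) (lookup πs l)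
    nested k l k<l = subst₂ NestedBelow (sym (lookup-πs k)) (sym (lookup-πs l))
      (paths-nested (index k) (index l) (subst₂ ℕ._<_ (sym (toℕ-index k)) (sym (toℕ-index l)) k<l))
    below-d : ∀ k (x : ℕ) y → (+ x , y) ∈ nonSinkPoints (lookup πs k) → y ℤ.≤ d x
    below-d k x y m = subst (λ c → y ℤ.≤ d c) (sym (ℤP.+-injective x≡))
      (ℤP.≤-trans (proj₂ (proj₂ (proj₂ (proj₂ (proj₂ on))))) (Hi≤d c _ (proj₁ (proj₂ (proj₂ (proj₂ on))))))
      where
      on : OnIntervals lam (suc (toℕ k)) (+ x , y)
      on = proj₁ (∈nonSink⇔OnIntervals k (+ x , y)) m
      c : ℕ
      c = proj₁ on
      x≡ : + x ≡ + c
      x≡ = proj₁ (proj₂ on)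

  πs-intervals : HasIntervals h d e lam πs
  πs-intervals = (λ c i c<h _ i≤g → subst (i ℕ.≤_) (sym (LP.length-tabulate Path.π)) (≤R c i c<h i≤g)) , intervals
    where
    intervals : ∀ c k → suc c ℕ.≤ h → + suc (toℕ k) ℤ.≤ g (suc c) → ∀ y →
      ((+ c , y) ∈ nonSinkPoints (lookup πs k)) ⇔ (Ilo h d e lam c (suc (toℕ k)) ℤ.≤ y × y ℤ.≤ Ihi h d e lam c (suc (toℕ k)))
    intervals c k c<h I≤g y = to , from
      where
      to : (+ c , y) ∈ nonSinkPoints (lookup πs k) → Ilo h d e lam c (suc (toℕ k)) ℤ.≤ y × y ℤ.≤ Ihi h d e lam c (suc (toℕ k))
      to m with proj₁ (∈nonSink⇔OnIntervals k (+ c , y)) m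
      ... | c′ , x≡ , _ , _ , y∈ = subst (λ c → Ilo h d e lam c (suc (toℕ k)) ℤ.≤ y × y ℤ.≤ Ihi h d e lam c (suc (toℕ k)))
                                      (sym (ℤP.+-injective x≡)) y∈
      from : Ilo h d e lam c (suc (toℕ k)) ℤ.≤ y × y ℤ.≤ Ihi h d e lam c (suc (toℕ k)) → (+ c , y) ∈ nonSinkPoints (lookup πs k)
      from y∈ = proj₂ (∈nonSink⇔OnIntervals k (+ c , y)) (c , refl , c<h , I≤g , y∈)

  private
    ≤-by-last : ∀ n → (∀ (f : Fin n) → suc (toℕ f) ℕ.≤ R) → n ℕ.≤ R
    ≤-by-last zero    _     = z≤n
    ≤-by-last (suc n) bound = subst (ℕ._≤ R) (cong suc (FinP.toℕ-fromℕ n)) (bound (Fin.fromℕ n))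

  πs-unique : (πs′ : List EEPath) → IsNest h d e πs′ → HasIntervals h d e lam πs′ → πs′ ≡ πs
  πs-unique πs′ nest′ intervals′ = ≡-by-lookup πs′ πs length≡ same-path
    where
    module N = Nest h p d e den πs′ nest′
    R≤length : ∀ n → n ≡ R → n ℕ.≤ length πs′
    R≤length zero    _ = z≤n
    R≤length (suc n) n+1≡R = let c , c<h , i≤g = maxG-attained h (suc n) ℕP.≤-refl (s≤s z≤n) (ℕP.≤-reflexive n+1≡R) in
      proj₁ intervals′ c (suc n) c<h (s≤s z≤n) i≤g
    length≡ : length πs′ ≡ length πs
    length≡ = trans (ℕP.≤-antisym (≤-by-last (length πs′) (λ f → ≤R (N.s f) (suc (toℕ f)) (N.s<h f) (proj₂ (N.source-range f))))
                                  (R≤length R refl))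
                    (sym (LP.length-tabulate Path.π))
    same-path : ∀ k → lookup πs′ k ≡ lookup πs (Fin.cast length≡ k)
    same-path k = path-determined-by-nonSinkPoints _ _ λ q →
      (λ m → proj₂ (∈nonSink⇔OnIntervals k′ q) (subst (λ n → OnIntervals lam (suc n) q) (sym k′≡) (proj₁ (N.∈nonSink⇔OnIntervals lam intervals′ k q) m))) ,
      (λ m → proj₂ (N.∈nonSink⇔OnIntervals lam intervals′ k q) (subst (λ n → OnIntervals lam (suc n) q) k′≡ (proj₁ (∈nonSink⇔OnIntervals k′ q) m)))
      where
      k′ : Fin (length πs)
      k′ = Fin.cast length≡ k
      k′≡ : toℕ k′ ≡ toℕ k
      k′≡ = FinP.toℕ-cast length≡ k

  part-ii : Σ (List EEPath) (λ πs → IsNest h d e πs × HasIntervals h d e lam πs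
    × ((πs′ : List EEPath) → IsNest h d e πs′ → HasIntervals h d e lam πs′ → πs′ ≡ πs))
  part-ii = πs , πs-nest , πs-intervals , πs-unique

lemma3p2p1 : (h : ℕ) (p : IrrationalCut) (d e : ℕ → ℤ) → IsDen h p d e →
    ((πs : List EEPath) → IsNest h d e πs →
      NonSinkColumns h d e πs
      × Σ (ℕ → List ℕ) (λ lam →
          LamFamily h d e lam × HasIntervals h d e lam πs
          × ((lam' : ℕ → List ℕ) → LamFamily h d e lam' → HasIntervals h d e lam' πs →
              ∀ k → 1 ℕ.≤ k → k ℕ.≤ h ∸ 1 → lam' k ≡ lam k)))
    × ((lam : ℕ → List ℕ) → LamFamily h d e lam → IntervalIneq h d e lam →
      Σ (List EEPath) (λ πs →
        IsNest h d e πs × HasIntervals h d e lam πs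
        × ((πs' : List EEPath) → IsNest h d e πs' → HasIntervals h d e lam πs' → πs' ≡ πs)))
lemma3p2p1 h p d e den =
  (λ πs nest → Nest.part-i h p d e den πs nest) ,
  (λ lam family ineq → Construction.part-ii h p d e den lam family ineq)
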